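{- For all integers $a,b,c\geq 0$, \[ \bigl(z^c\ \text{ш}\ (-y)^b\bigr)(-y)^{a+1}-z^c\bigl(z^b\ \text{ш}\ (-y)^a\bigr)(-y)\ \in\ \sum_{n\geq 1}\bigl(y^n\ast \mathfrak{h}y\bigr), \] where $y^n\ast\mathfrak{h}y=\{y^n\ast w: w\in\mathfrak{h}y\}$ and the sum is the sum of these $\mathbb{Q}$-subspaces of $\mathfrak{h}$.
   Context: Let $\mathfrak{h}=\mathbb{Q}\langle x,y\rangle$ be the noncommutative polynomial algebra over $\mathbb{Q}$ in $x,y$; let $\mathfrak{h}y$ be the $\mathbb{Q}$-span of words ending in $y$ and $\mathfrak{h}^1=\mathbb{Q}+\mathfrak{h}y$. Let $z=x+y$. The shuffle product $\text{ш}$ on $\mathfrak{h}$ is the $\mathbb{Q}$-bilinear map with $1\ \text{ш}\ w=w\ \text{ш}\ 1=w$ and $uw\ \text{ш}\ vw'=u(w\ \text{ш}\ vw')+v(uw\ \text{ш}\ w')$ for letters $u,v\in\{x,y\}$ and words $w,w'$. Put $z_k=x^{k-1}y$ for $k\geq1$. The harmonic product $\ast$ on $\mathfrak{h}^1$ is the $\mathbb{Q}$-bilinear map with $1\ast w=w\ast 1=w$ and $z_kw\ast z_lw'=z_k(w\ast z_lw')+z_l(z_kw\ast w')+z_{k+l}(w\ast w')$ for $k,l\geq1$ and words $w,w'\in\mathfrak{h}^1$. -}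

module Defs where

open import Data.Nat as ℕ using (ℕ; zero; suc; _≥_)
open import Data.Rational as ℚ using (ℚ; 0ℚ; 1ℚ)
open import Data.List using (List; []; _∷_; _++_; [_]; map; concatMap; replicate; foldr)
open import Data.List.Properties using (≡-dec)
open import Data.Product using (_×_; _,_; ∃)
open import Data.List.Relation.Unary.All using (All)
open import Relation.Binary.PropositionalEquality using (_≡_; refl)
open import Relation.Nullary using (yes; no; Dec)

data Letter : Set where
  x y : Letter

_≟L_ : (a b : Letter) → Dec (a ≡ b)
x ≟L x = yes refl
x ≟L y = no λ ()
y ≟L x = no λ ()
y ≟L y = yes refl

Word : Set
Word = List Letter

_≟W_ : (u v : Word) → Dec (u ≡ v)
_≟W_ = ≡-dec _≟L_

-- Elements of 𝔥: finite formal ℚ-linear combinations of words.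
Poly : Set
Poly = List (ℚ × Word)

coeff : Poly → Word → ℚ
coeff [] w = 0ℚ
coeff ((q , u) ∷ p) w with u ≟W w
... | yes _ = q ℚ.+ coeff p w
... | no  _ = coeff p w

_≈_ : Poly → Poly → Set
p ≈ p' = ∀ w → coeff p w ≡ coeff p' w

infix 4 _≈_
infixl 6 _⊕_ _⊝_
infixl 7 _·_

0P : Poly
0P = []

_⊕_ : Poly → Poly → Poly
_⊕_ = _++_

_⊝_ : Poly → Poly → Poly
p ⊝ p' = p ++ map (λ { (q , u) → (ℚ.- q , u) }) p'

scale : ℚ → Poly → Poly
scale c = map (λ { (q , u) → (c ℚ.* q , u) })

word : Word → Poly
word u = [ (1ℚ , u) ]

_·_ : Poly → Poly → Poly
p · p' = concatMap (λ { (q , u) → map (λ { (q' , v) → (q ℚ.* q' , u ++ v) }) p' }) p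

_^_ : Poly → ℕ → Poly
p ^ zero = word []
p ^ suc n = p · (p ^ n)

zP : Poly
zP = word [ x ] ⊕ word [ y ]

yP : Poly
yP = word [ y ]

myP : Poly
myP = scale (ℚ.- 1ℚ) yP

prefix : Letter → Poly → Poly
prefix a = map (λ { (q , u) → (q , a ∷ u) })

shW : Word → Word → Poly
shW [] v = word v
shW (a ∷ u) [] = word (a ∷ u)
shW (a ∷ u) (b ∷ v) = prefix a (shW u (b ∷ v)) ⊕ prefix b (shW (a ∷ u) v)

_ш_ : Poly → Poly → Poly
p ш p' = concatMap (λ { (q , u) → concatMap (λ { (q' , v) → scale (q ℚ.* q') (shW u v) }) p' }) p

-- Words of 𝔥¹ as sequences (k₁,…,k_r) for z_{k₁}⋯z_{k_r}, z_k = x^{k-1}y;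
-- an entry m stands for k = m+1.
toComp' : ℕ → Word → List ℕ
toComp' m [] = []          -- trailing x's (never occurs for words of 𝔥¹)
toComp' m (x ∷ w) = toComp' (suc m) w
toComp' m (y ∷ w) = m ∷ toComp' 0 w

toComp : Word → List ℕ
toComp = toComp' 0

zk : ℕ → Word      -- zk m = x^m y = z_{m+1}
zk m = replicate m x ++ [ y ]

fromComp : List ℕ → Word
fromComp [] = []
fromComp (m ∷ ms) = zk m ++ fromComp ms

prefixW : Word → Poly → Poly
prefixW a = map (λ { (q , u) → (q , a ++ u) })

-- harmonic product on words of 𝔥¹ (given as index sequences):
-- z_k w ∗ z_l w' = z_k (w ∗ z_l w') + z_l (z_k w ∗ w') + z_{k+l} (w ∗ w')
hC : List ℕ → List ℕ → Poly
hC [] v = word (fromComp v)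
hC (a ∷ u) [] = word (fromComp (a ∷ u))
hC (a ∷ u) (b ∷ v) =
  prefixW (zk a) (hC u (b ∷ v)) ⊕ prefixW (zk b) (hC (a ∷ u) v)
    ⊕ prefixW (zk (suc (a ℕ.+ b))) (hC u v)

hW : Word → Word → Poly
hW u v = hC (toComp u) (toComp v)

_⋆_ : Poly → Poly → Poly
p ⋆ p' = concatMap (λ { (q , u) → concatMap (λ { (q' , v) → scale (q ℚ.* q') (hW u v) }) p' }) p

EndsInY : Word → Set
EndsInY w = ∃ λ u → w ≡ u ++ [ y ]

In𝔥y : Poly → Set
In𝔥y p = All (λ { (q , u) → EndsInY u }) p

InSumYnStar : Poly → Set
InSumYnStar p = ∃ λ (L : List (ℕ × Poly)) →
  All (λ { (n , w) → (n ≥ 1) × In𝔥y w }) L ×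
  (p ≈ foldr (λ { (n , w) acc → ((yP ^ n) ⋆ w) ⊕ acc }) 0P L)

{-# OPTIONS --safe #-}
-- Write w m = z^c (z^m ш (-y)^a) y, an element of 𝔥y. The key identity is
--   Σ_{n+m=b} (-1)ⁿ yⁿ ∗ w m = -(z^c ш (-y)^b) (-y)^{a+1},
-- so the left-hand side is w b minus this alternating sum; since y⁰ ∗ w b = w b, what
-- remains is a combination of the yⁿ ∗ w m with n ≥ 1.
-- The identity is proved by induction on c and then b, from the shuffle recursion for
-- z P ш (-y) Q and the harmonic recursion yⁿ⁺¹ ∗ z p = y (yⁿ ∗ z p) + z (yⁿ⁺¹ ∗ p) on 𝔥y,
-- in which the terms x y (yⁿ ∗ p) coming from x p and y p cancel. For c = 0 it follows by
-- induction on a from the fact that, if U m = Σ_{j ≤ m} z^{m-j} y V j, the alternating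
-- yⁿ-∗-sums of the U m are y times those of the V m.
module Submission where

open import Defs
open import Data.Nat as ℕ using (ℕ; zero; suc)
import Data.Nat.Properties as ℕP
open import Data.Rational using (ℚ; 0ℚ; 1ℚ; _+_; _*_; -_)
import Data.Rational.Properties as ℚP
open import Data.List using (List; []; _∷_; _++_; [_]; map; concatMap; replicate; foldr; length)
import Data.List.Properties as ListP
open import Data.List.Relation.Unary.All using (All; []; _∷_)
open import Data.List.Relation.Unary.All.Properties using (++⁺)
open import Data.Product using (_×_; _,_; ∃; proj₂)
open import Data.Fin using (Fin; zero; suc)
open import Data.Vec as Vec using (Vec; []; _∷_; lookup)
open import Data.Vec.Properties using (lookup-map)
open import Data.Empty using (⊥-elim)
open import Relation.Binary.PropositionalEquality hiding ([_])
open import Relation.Binary.Bundles using (Setoid)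
import Relation.Binary.Reasoning.Setoid as SetoidReasoning
open import Relation.Nullary using (yes; no; ¬_)
open import Algebra using (CommutativeMonoid; CommutativeRing)
open import Algebra.Properties.CommutativeSemigroup
  (CommutativeMonoid.commutativeSemigroup ℚP.+-0-commutativeMonoid) using (interchange)
open import Algebra.Properties.Ring (CommutativeRing.ring ℚP.+-*-commutativeRing) using (-1*x≈-x)

infix 4 _≋_

neg : Poly → Poly
neg p = 0P ⊝ p

coeff-⊕ : ∀ p q w → coeff (p ⊕ q) w ≡ coeff p w + coeff q w
coeff-⊕ [] q w = sym (ℚP.+-identityˡ _)
coeff-⊕ ((r , u) ∷ p) q w with u ≟W w
... | yes _ = trans (cong (r +_) (coeff-⊕ p q w)) (sym (ℚP.+-assoc r _ _))
... | no _ = coeff-⊕ p q w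

coeff-neg : ∀ p w → coeff (neg p) w ≡ - coeff p w
coeff-neg [] w = refl
coeff-neg ((r , u) ∷ p) w with u ≟W w
... | yes _ = trans (cong (- r +_) (coeff-neg p w)) (sym (ℚP.neg-distrib-+ r _))
... | no _ = coeff-neg p w

coeff-⊝ : ∀ p q w → coeff (p ⊝ q) w ≡ coeff p w + - coeff q w
coeff-⊝ p q w = trans (coeff-⊕ p (neg q) w) (cong (coeff p w +_) (coeff-neg q w))

coeff-scale : ∀ c p w → coeff (scale c p) w ≡ c * coeff p w
coeff-scale c [] w = sym (ℚP.*-zeroʳ c)
coeff-scale c ((r , u) ∷ p) w with u ≟W w
... | yes _ = trans (cong (c * r +_) (coeff-scale c p w)) (sym (ℚP.*-distribˡ-+ c r _))
... | no _ = coeff-scale c p w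

-- The relation _≈_ of Defs wrapped in a record, so that p and q can be inferred from a proof.
record _≋_ (p q : Poly) : Set where
  constructor mk≋
  field coeff-≡ : ∀ w → coeff p w ≡ coeff q w
open _≋_ public

≋-refl : ∀ {p} → p ≋ p
≋-refl = mk≋ λ w → refl

≋-sym : ∀ {p q} → p ≋ q → q ≋ p
≋-sym e = mk≋ λ w → sym (coeff-≡ e w)

≋-trans : ∀ {p q r} → p ≋ q → q ≋ r → p ≋ r
≋-trans e f = mk≋ λ w → trans (coeff-≡ e w) (coeff-≡ f w)

≡⇒≋ : ∀ {p q} → p ≡ q → p ≋ q
≡⇒≋ refl = ≋-refl

≋-setoid : Setoid _ _
≋-setoid = record
  { Carrier = Poly ; _≈_ = _≋_
  ; isEquivalence = record { refl = ≋-refl ; sym = ≋-sym ; trans = ≋-trans } }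

module ≋-Reasoning = SetoidReasoning ≋-setoid

⊕-cong : ∀ {p p′ q q′} → p ≋ p′ → q ≋ q′ → p ⊕ q ≋ p′ ⊕ q′
⊕-cong {p} {p′} {q} {q′} e f = mk≋ λ w →
  trans (coeff-⊕ p q w) (trans (cong₂ _+_ (coeff-≡ e w) (coeff-≡ f w)) (sym (coeff-⊕ p′ q′ w)))

neg-cong : ∀ {p p′} → p ≋ p′ → neg p ≋ neg p′
neg-cong {p} {p′} e = mk≋ λ w →
  trans (coeff-neg p w) (trans (cong -_ (coeff-≡ e w)) (sym (coeff-neg p′ w)))

⊝-cong : ∀ {p p′ q q′} → p ≋ p′ → q ≋ q′ → p ⊝ q ≋ p′ ⊝ q′
⊝-cong e f = ⊕-cong e (neg-cong f)

scale-cong : ∀ c {p p′} → p ≋ p′ → scale c p ≋ scale c p′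
scale-cong c {p} {p′} e = mk≋ λ w →
  trans (coeff-scale c p w) (trans (cong (c *_) (coeff-≡ e w)) (sym (coeff-scale c p′ w)))

scale-1ℚ : ∀ p → scale 1ℚ p ≋ p
scale-1ℚ p = mk≋ λ w → trans (coeff-scale 1ℚ p w) (ℚP.*-identityˡ _)

scale-[-1ℚ] : ∀ p → scale ((- 1ℚ) * 1ℚ) p ≋ neg p
scale-[-1ℚ] p = mk≋ λ w →
  trans (coeff-scale ((- 1ℚ) * 1ℚ) p w) (trans (-1*x≈-x (coeff p w)) (sym (coeff-neg p w)))

scale-scale : ∀ c d p → scale c (scale d p) ≡ scale (c * d) p
scale-scale c d [] = refl
scale-scale c d ((q , u) ∷ p) =
  cong₂ _∷_ (cong (_, u) (sym (ℚP.*-assoc c d q))) (scale-scale c d p)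

scale-⊕ : ∀ c p p′ → scale c (p ⊕ p′) ≡ scale c p ⊕ scale c p′
scale-⊕ c p p′ = ListP.map-++ _ p p′

-- Identities between formal ℤ-linear combinations of polynomials, decided by comparing
-- coefficient vectors.
module LinearCombination where

  infixl 6 _⊞_ _⊟_

  data Expr (n : ℕ) : Set where
    var : Fin n → Expr n
    _⊞_ _⊟_ : Expr n → Expr n → Expr n
    ⊟_ : Expr n → Expr n
    ∅ : Expr n

  ⟦_⟧ : ∀ {n} → Expr n → Vec Poly n → Poly
  ⟦ var i ⟧ ρ = lookup ρ i
  ⟦ e ⊞ f ⟧ ρ = ⟦ e ⟧ ρ ⊕ ⟦ f ⟧ ρ
  ⟦ e ⊟ f ⟧ ρ = ⟦ e ⟧ ρ ⊝ ⟦ f ⟧ ρ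
  ⟦ ⊟ e ⟧ ρ = neg (⟦ e ⟧ ρ)
  ⟦ ∅ ⟧ ρ = 0P

  ⟦_⟧ℚ : ∀ {n} → Expr n → Vec ℚ n → ℚ
  ⟦ var i ⟧ℚ ρ = lookup ρ i
  ⟦ e ⊞ f ⟧ℚ ρ = ⟦ e ⟧ℚ ρ + ⟦ f ⟧ℚ ρ
  ⟦ e ⊟ f ⟧ℚ ρ = ⟦ e ⟧ℚ ρ + - ⟦ f ⟧ℚ ρ
  ⟦ ⊟ e ⟧ℚ ρ = - ⟦ e ⟧ℚ ρ
  ⟦ ∅ ⟧ℚ ρ = 0ℚ

  basis : ∀ {n} → Fin n → Vec ℚ n
  basis zero = 1ℚ ∷ Vec.replicate _ 0ℚ
  basis (suc i) = 0ℚ ∷ basis i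

  normalise : ∀ {n} → Expr n → Vec ℚ n
  normalise (var i) = basis i
  normalise (e ⊞ f) = Vec.zipWith _+_ (normalise e) (normalise f)
  normalise (e ⊟ f) = Vec.zipWith _+_ (normalise e) (Vec.map -_ (normalise f))
  normalise (⊟ e) = Vec.map -_ (normalise e)
  normalise ∅ = Vec.replicate _ 0ℚ

  dot : ∀ {n} → Vec ℚ n → Vec ℚ n → ℚ
  dot [] [] = 0ℚ
  dot (a ∷ u) (r ∷ ρ) = a * r + dot u ρ

  dot-zeros : ∀ {n} (ρ : Vec ℚ n) → dot (Vec.replicate n 0ℚ) ρ ≡ 0ℚ
  dot-zeros [] = refl
  dot-zeros (r ∷ ρ) = trans (cong₂ _+_ (ℚP.*-zeroˡ r) (dot-zeros ρ)) (ℚP.+-identityˡ 0ℚ)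

  dot-basis : ∀ {n} (i : Fin n) (ρ : Vec ℚ n) → dot (basis i) ρ ≡ lookup ρ i
  dot-basis zero (r ∷ ρ) = trans (cong₂ _+_ (ℚP.*-identityˡ r) (dot-zeros ρ)) (ℚP.+-identityʳ r)
  dot-basis (suc i) (r ∷ ρ) = trans (cong₂ _+_ (ℚP.*-zeroˡ r) (dot-basis i ρ)) (ℚP.+-identityˡ _)

  dot-+ : ∀ {n} (u v ρ : Vec ℚ n) → dot (Vec.zipWith _+_ u v) ρ ≡ dot u ρ + dot v ρ
  dot-+ [] [] [] = sym (ℚP.+-identityˡ 0ℚ)
  dot-+ (a ∷ u) (b ∷ v) (r ∷ ρ) =
    trans (cong₂ _+_ (ℚP.*-distribʳ-+ r a b) (dot-+ u v ρ)) (interchange (a * r) (b * r) _ _)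

  dot-neg : ∀ {n} (u ρ : Vec ℚ n) → dot (Vec.map -_ u) ρ ≡ - dot u ρ
  dot-neg [] [] = refl
  dot-neg (a ∷ u) (r ∷ ρ) =
    trans (cong₂ _+_ (sym (ℚP.neg-distribˡ-* a r)) (dot-neg u ρ)) (sym (ℚP.neg-distrib-+ (a * r) _))

  ⟦⟧ℚ-normalise : ∀ {n} (e : Expr n) ρ → ⟦ e ⟧ℚ ρ ≡ dot (normalise e) ρ
  ⟦⟧ℚ-normalise (var i) ρ = sym (dot-basis i ρ)
  ⟦⟧ℚ-normalise (e ⊞ f) ρ =
    trans (cong₂ _+_ (⟦⟧ℚ-normalise e ρ) (⟦⟧ℚ-normalise f ρ)) (sym (dot-+ (normalise e) (normalise f) ρ))
  ⟦⟧ℚ-normalise (e ⊟ f) ρ =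
    trans (cong₂ _+_ (⟦⟧ℚ-normalise e ρ) (trans (cong -_ (⟦⟧ℚ-normalise f ρ)) (sym (dot-neg (normalise f) ρ))))
          (sym (dot-+ (normalise e) _ ρ))
  ⟦⟧ℚ-normalise (⊟ e) ρ = trans (cong -_ (⟦⟧ℚ-normalise e ρ)) (sym (dot-neg (normalise e) ρ))
  ⟦⟧ℚ-normalise ∅ ρ = sym (dot-zeros ρ)

  coeffs : ∀ {n} → Vec Poly n → Word → Vec ℚ n
  coeffs ρ w = Vec.map (λ p → coeff p w) ρ

  coeff-⟦⟧ : ∀ {n} (e : Expr n) ρ w → coeff (⟦ e ⟧ ρ) w ≡ ⟦ e ⟧ℚ (coeffs ρ w)
  coeff-⟦⟧ (var i) ρ w = sym (lookup-map i _ ρ)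
  coeff-⟦⟧ (e ⊞ f) ρ w = trans (coeff-⊕ (⟦ e ⟧ ρ) _ w) (cong₂ _+_ (coeff-⟦⟧ e ρ w) (coeff-⟦⟧ f ρ w))
  coeff-⟦⟧ (e ⊟ f) ρ w =
    trans (coeff-⊝ (⟦ e ⟧ ρ) _ w) (cong₂ _+_ (coeff-⟦⟧ e ρ w) (cong -_ (coeff-⟦⟧ f ρ w)))
  coeff-⟦⟧ (⊟ e) ρ w = trans (coeff-neg (⟦ e ⟧ ρ) w) (cong -_ (coeff-⟦⟧ e ρ w))
  coeff-⟦⟧ ∅ ρ w = refl

  solve : ∀ {n} (e f : Expr n) (ρ : Vec Poly n) → normalise e ≡ normalise f → ⟦ e ⟧ ρ ≋ ⟦ f ⟧ ρ
  solve e f ρ eq = mk≋ λ w → begin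
    coeff (⟦ e ⟧ ρ) w           ≡⟨ coeff-⟦⟧ e ρ w ⟩
    ⟦ e ⟧ℚ (coeffs ρ w)         ≡⟨ ⟦⟧ℚ-normalise e _ ⟩
    dot (normalise e) (coeffs ρ w) ≡⟨ cong (λ v → dot v (coeffs ρ w)) eq ⟩
    dot (normalise f) (coeffs ρ w) ≡⟨ sym (⟦⟧ℚ-normalise f _) ⟩
    ⟦ f ⟧ℚ (coeffs ρ w)         ≡⟨ sym (coeff-⟦⟧ f ρ w) ⟩
    coeff (⟦ f ⟧ ρ) w           ∎
    where open ≡-Reasoning

  v₀ : ∀ {n} → Expr (1 ℕ.+ n)
  v₀ = var zero
  v₁ : ∀ {n} → Expr (2 ℕ.+ n)
  v₁ = var (suc zero)
  v₂ : ∀ {n} → Expr (3 ℕ.+ n)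
  v₂ = var (suc (suc zero))
  v₃ : ∀ {n} → Expr (4 ℕ.+ n)
  v₃ = var (suc (suc (suc zero)))
  v₄ : ∀ {n} → Expr (5 ℕ.+ n)
  v₄ = var (suc (suc (suc (suc zero))))

open LinearCombination using (solve; v₀; v₁; v₂; v₃; v₄; _⊞_; _⊟_; ⊟_; ∅)

⊕-identityʳ : ∀ p → p ⊕ 0P ≋ p
⊕-identityʳ p = solve (v₀ ⊞ ∅) v₀ (p ∷ []) refl

neg-involutive : ∀ p → neg (neg p) ≋ p
neg-involutive p = solve (⊟ ⊟ v₀) v₀ (p ∷ []) refl

neg-⊕ : ∀ p q → neg (p ⊕ q) ≋ neg p ⊕ neg q
neg-⊕ p q = solve (⊟ (v₀ ⊞ v₁)) (⊟ v₀ ⊞ ⊟ v₁) (p ∷ q ∷ []) refl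

coeff-prefix-≡ : ∀ a p w → coeff (prefix a p) (a ∷ w) ≡ coeff p w
coeff-prefix-≡ a [] w = refl
coeff-prefix-≡ x ((q , u) ∷ p) w with u ≟W w
... | yes _ = cong (q +_) (coeff-prefix-≡ x p w)
... | no _ = coeff-prefix-≡ x p w
coeff-prefix-≡ y ((q , u) ∷ p) w with u ≟W w
... | yes _ = cong (q +_) (coeff-prefix-≡ y p w)
... | no _ = coeff-prefix-≡ y p w

coeff-prefix-≢ : ∀ {a b} p w → ¬ a ≡ b → coeff (prefix a p) (b ∷ w) ≡ 0ℚ
coeff-prefix-≢ [] w a≢b = refl
coeff-prefix-≢ {x} {x} (_ ∷ p) w a≢b = ⊥-elim (a≢b refl)
coeff-prefix-≢ {x} {y} (_ ∷ p) w a≢b = coeff-prefix-≢ p w a≢b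
coeff-prefix-≢ {y} {x} (_ ∷ p) w a≢b = coeff-prefix-≢ p w a≢b
coeff-prefix-≢ {y} {y} (_ ∷ p) w a≢b = ⊥-elim (a≢b refl)

coeff-prefix-[] : ∀ a p → coeff (prefix a p) [] ≡ 0ℚ
coeff-prefix-[] a [] = refl
coeff-prefix-[] a (_ ∷ p) = coeff-prefix-[] a p

prefix-cong : ∀ a {p p′} → p ≋ p′ → prefix a p ≋ prefix a p′
prefix-cong a {p} {p′} e = mk≋ at
  where
  at : ∀ w → coeff (prefix a p) w ≡ coeff (prefix a p′) w
  at [] = trans (coeff-prefix-[] a p) (sym (coeff-prefix-[] a p′))
  at (b ∷ w) with a ≟L b
  ... | yes refl = trans (coeff-prefix-≡ a p w) (trans (coeff-≡ e w) (sym (coeff-prefix-≡ a p′ w)))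
  ... | no a≢b = trans (coeff-prefix-≢ p w a≢b) (sym (coeff-prefix-≢ p′ w a≢b))

prefix-⊕ : ∀ a p q → prefix a (p ⊕ q) ≡ prefix a p ⊕ prefix a q
prefix-⊕ a p q = ListP.map-++ _ p q

prefix-neg : ∀ a p → prefix a (neg p) ≡ neg (prefix a p)
prefix-neg a [] = refl
prefix-neg a (_ ∷ p) = cong (_ ∷_) (prefix-neg a p)

prefix-scale : ∀ a c p → prefix a (scale c p) ≡ scale c (prefix a p)
prefix-scale a c [] = refl
prefix-scale a c (_ ∷ p) = cong (_ ∷_) (prefix-scale a c p)

prefixW-[] : ∀ p → prefixW [] p ≡ p
prefixW-[] [] = refl
prefixW-[] (t ∷ p) = cong (t ∷_) (prefixW-[] p)

prefixW-[_] : ∀ a p → prefixW [ a ] p ≡ prefix a p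
prefixW-[ a ] [] = refl
prefixW-[ a ] (t ∷ p) = cong (_ ∷_) (prefixW-[ a ] p)

prefixW-∷ : ∀ a u p → prefixW (a ∷ u) p ≡ prefix a (prefixW u p)
prefixW-∷ a u [] = refl
prefixW-∷ a u (t ∷ p) = cong (_ ∷_) (prefixW-∷ a u p)

record IsLinear (f : Poly → Poly) : Set where
  field
    cong-≋ : ∀ {p q} → p ≋ q → f p ≋ f q
    ⊕-hom : ∀ p q → f (p ⊕ q) ≋ f p ⊕ f q
    neg-hom : ∀ p → f (neg p) ≋ neg (f p)
open IsLinear public

∘-linear : ∀ {f g} → IsLinear f → IsLinear g → IsLinear (λ p → f (g p))
∘-linear F G = record
  { cong-≋ = λ e → cong-≋ F (cong-≋ G e)
  ; ⊕-hom = λ p q → ≋-trans (cong-≋ F (⊕-hom G p q)) (⊕-hom F _ _)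
  ; neg-hom = λ p → ≋-trans (cong-≋ F (neg-hom G p)) (neg-hom F _) }

neg-linear : IsLinear neg
neg-linear = record { cong-≋ = neg-cong ; ⊕-hom = neg-⊕ ; neg-hom = λ p → ≋-refl }

prefix-linear : ∀ a → IsLinear (prefix a)
prefix-linear a = record
  { cong-≋ = prefix-cong a
  ; ⊕-hom = λ p q → ≡⇒≋ (prefix-⊕ a p q)
  ; neg-hom = λ p → ≡⇒≋ (prefix-neg a p) }

eval : Poly → (Word → ℚ) → ℚ
eval [] g = 0ℚ
eval ((q , u) ∷ p) g = q * g u + eval p g

eval-⊕ : ∀ p p′ g → eval (p ⊕ p′) g ≡ eval p g + eval p′ g
eval-⊕ [] p′ g = sym (ℚP.+-identityˡ _)
eval-⊕ ((q , u) ∷ p) p′ g =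
  trans (cong (q * g u +_) (eval-⊕ p p′ g)) (sym (ℚP.+-assoc (q * g u) (eval p g) (eval p′ g)))

eval-neg : ∀ p g → eval (neg p) g ≡ - eval p g
eval-neg [] g = refl
eval-neg ((q , u) ∷ p) g = trans (cong₂ _+_ (sym (ℚP.neg-distribˡ-* q (g u))) (eval-neg p g))
                                 (sym (ℚP.neg-distrib-+ (q * g u) (eval p g)))

eval-congʳ : ∀ p {g g′} → (∀ u → g u ≡ g′ u) → eval p g ≡ eval p g′
eval-congʳ [] e = refl
eval-congʳ ((q , u) ∷ p) e = cong₂ _+_ (cong (q *_) (e u)) (eval-congʳ p e)

eval-+ʳ : ∀ p g g′ → eval p (λ u → g u + g′ u) ≡ eval p g + eval p g′
eval-+ʳ [] g g′ = sym (ℚP.+-identityˡ 0ℚ)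
eval-+ʳ ((q , u) ∷ p) g g′ =
  trans (cong₂ _+_ (ℚP.*-distribˡ-+ q (g u) (g′ u)) (eval-+ʳ p g g′))
        (interchange (q * g u) (q * g′ u) (eval p g) (eval p g′))

eval-negʳ : ∀ p g → eval p (λ u → - g u) ≡ - eval p g
eval-negʳ [] g = refl
eval-negʳ ((q , u) ∷ p) g = trans (cong₂ _+_ (sym (ℚP.neg-distribʳ-* q (g u))) (eval-negʳ p g))
                                  (sym (ℚP.neg-distrib-+ (q * g u) (eval p g)))

removeWord : Word → Poly → Poly
removeWord u [] = []
removeWord u ((q , v) ∷ p) with v ≟W u
... | yes _ = removeWord u p
... | no _ = (q , v) ∷ removeWord u p

eval-removeWord : ∀ u p g → eval p g ≡ coeff p u * g u + eval (removeWord u p) g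
eval-removeWord u [] g = sym (trans (cong (_+ 0ℚ) (ℚP.*-zeroˡ (g u))) (ℚP.+-identityˡ 0ℚ))
eval-removeWord u ((q , v) ∷ p) g with v ≟W u
... | yes refl = begin
    q * g v + eval p g                                       ≡⟨ cong (q * g v +_) (eval-removeWord v p g) ⟩
    q * g v + (coeff p v * g v + eval (removeWord v p) g)     ≡⟨ sym (ℚP.+-assoc (q * g v) _ _) ⟩
    (q * g v + coeff p v * g v) + eval (removeWord v p) g     ≡⟨ cong (_+ _) (sym (ℚP.*-distribʳ-+ (g v) q _)) ⟩
    (q + coeff p v) * g v + eval (removeWord v p) g           ∎
  where open ≡-Reasoning
... | no _ = begin
    q * g v + eval p g                                       ≡⟨ cong (q * g v +_) (eval-removeWord u p g) ⟩
    q * g v + (coeff p u * g u + eval (removeWord u p) g)     ≡⟨ sym (ℚP.+-assoc (q * g v) _ _) ⟩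
    (q * g v + coeff p u * g u) + eval (removeWord u p) g     ≡⟨ cong (_+ _) (ℚP.+-comm (q * g v) _) ⟩
    (coeff p u * g u + q * g v) + eval (removeWord u p) g     ≡⟨ ℚP.+-assoc (coeff p u * g u) _ _ ⟩
    coeff p u * g u + (q * g v + eval (removeWord u p) g)     ∎
  where open ≡-Reasoning

coeff-removeWord-≡ : ∀ u p → coeff (removeWord u p) u ≡ 0ℚ
coeff-removeWord-≡ u [] = refl
coeff-removeWord-≡ u ((q , v) ∷ p) with v ≟W u
... | yes _ = coeff-removeWord-≡ u p
... | no v≢u with v ≟W u
...   | yes v≡u = ⊥-elim (v≢u v≡u)
...   | no _ = coeff-removeWord-≡ u p

coeff-removeWord-≢ : ∀ u p w → ¬ w ≡ u → coeff (removeWord u p) w ≡ coeff p w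
coeff-removeWord-≢ u [] w w≢u = refl
coeff-removeWord-≢ u ((q , v) ∷ p) w w≢u with v ≟W u
... | yes refl with v ≟W w
...   | yes refl = ⊥-elim (w≢u refl)
...   | no _ = coeff-removeWord-≢ u p w w≢u
coeff-removeWord-≢ u ((q , v) ∷ p) w w≢u | no _ with v ≟W w
...   | yes _ = cong (q +_) (coeff-removeWord-≢ u p w w≢u)
...   | no _ = coeff-removeWord-≢ u p w w≢u

length-removeWord : ∀ u p → length (removeWord u p) ℕ.≤ length p
length-removeWord u [] = ℕ.z≤n
length-removeWord u ((q , v) ∷ p) with v ≟W u
... | yes _ = ℕP.m≤n⇒m≤1+n (length-removeWord u p)
... | no _ = ℕ.s≤s (length-removeWord u p)

-- Induction on the length of p: removing all occurrences of one word strictly shortens p.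
eval-coeff-zero : ∀ n p → length p ℕ.≤ n → (∀ w → coeff p w ≡ 0ℚ) → ∀ g → eval p g ≡ 0ℚ
eval-coeff-zero n [] _ _ g = refl
eval-coeff-zero (suc n) ((q , u) ∷ p) (ℕ.s≤s len≤n) p≋0 g = begin
    eval ((q , u) ∷ p) g                                            ≡⟨ eval-removeWord u ((q , u) ∷ p) g ⟩
    coeff ((q , u) ∷ p) u * g u + eval (removeWord u ((q , u) ∷ p)) g
      ≡⟨ cong₂ _+_ (trans (cong (_* g u) (p≋0 u)) (ℚP.*-zeroˡ (g u))) rest ⟩
    0ℚ + 0ℚ                                                         ≡⟨ ℚP.+-identityˡ 0ℚ ⟩
    0ℚ                                                              ∎
  where
  open ≡-Reasoning
  removed≋0 : ∀ w → coeff (removeWord u ((q , u) ∷ p)) w ≡ 0ℚ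
  removed≋0 w with w ≟W u
  ... | yes refl = coeff-removeWord-≡ w ((q , w) ∷ p)
  ... | no w≢u = trans (coeff-removeWord-≢ u ((q , u) ∷ p) w w≢u) (p≋0 w)
  rest : eval (removeWord u ((q , u) ∷ p)) g ≡ 0ℚ
  rest with u ≟W u | removed≋0
  ... | yes _ | removed≋0′ =
    eval-coeff-zero n (removeWord u p) (ℕP.≤-trans (length-removeWord u p) len≤n) removed≋0′ g
  ... | no u≢u | _ = ⊥-elim (u≢u refl)

eval-congˡ : ∀ {p p′} → p ≋ p′ → ∀ g → eval p g ≡ eval p′ g
eval-congˡ {p} {p′} e g = begin
    eval p g                                 ≡⟨ sym (ℚP.+-identityʳ _) ⟩
    eval p g + 0ℚ                            ≡⟨ cong (eval p g +_) (sym (ℚP.+-inverseˡ (eval p′ g))) ⟩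
    eval p g + (- eval p′ g + eval p′ g)     ≡⟨ sym (ℚP.+-assoc (eval p g) (- eval p′ g) (eval p′ g)) ⟩
    (eval p g + - eval p′ g) + eval p′ g     ≡⟨ cong (_+ eval p′ g) difference≡0 ⟩
    0ℚ + eval p′ g                           ≡⟨ ℚP.+-identityˡ _ ⟩
    eval p′ g                                ∎
  where
  open ≡-Reasoning
  p⊝p′≋0 : ∀ w → coeff (p ⊝ p′) w ≡ 0ℚ
  p⊝p′≋0 w = trans (coeff-⊝ p p′ w) (trans (cong (_+ - coeff p′ w) (coeff-≡ e w)) (ℚP.+-inverseʳ (coeff p′ w)))
  difference≡0 : eval p g + - eval p′ g ≡ 0ℚ
  difference≡0 = trans (cong (eval p g +_) (sym (eval-neg p′ g)))
                   (trans (sym (eval-⊕ p (neg p′) g)) (eval-coeff-zero _ (p ⊝ p′) ℕP.≤-refl p⊝p′≋0 g))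

extend : (Word → Poly) → Poly → Poly
extend G p = concatMap (λ { (q , u) → scale q (G u) }) p

coeff-extend : ∀ G p w → coeff (extend G p) w ≡ eval p (λ u → coeff (G u) w)
coeff-extend G [] w = refl
coeff-extend G ((q , u) ∷ p) w =
  trans (coeff-⊕ (scale q (G u)) (extend G p) w) (cong₂ _+_ (coeff-scale q (G u) w) (coeff-extend G p w))

extend-congʳ : ∀ G {p p′} → p ≋ p′ → extend G p ≋ extend G p′
extend-congʳ G {p} {p′} e = mk≋ λ w →
  trans (coeff-extend G p w) (trans (eval-congˡ e _) (sym (coeff-extend G p′ w)))

extend-congˡ : ∀ {G G′} p → (∀ u → G u ≋ G′ u) → extend G p ≋ extend G′ p
extend-congˡ {G} {G′} p e = mk≋ λ w →
  trans (coeff-extend G p w) (trans (eval-congʳ p (λ u → coeff-≡ (e u) w)) (sym (coeff-extend G′ p w)))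

extend-congᴾ : ∀ {P : Word → Set} {G G′} p → All (λ t → P (proj₂ t)) p →
               (∀ u → P u → G u ≋ G′ u) → extend G p ≋ extend G′ p
extend-congᴾ [] [] e = ≋-refl
extend-congᴾ ((q , u) ∷ p) (pu ∷ ps) e = ⊕-cong (scale-cong q (e u pu)) (extend-congᴾ p ps e)

extend-⊕ : ∀ G p p′ → extend G (p ⊕ p′) ≡ extend G p ⊕ extend G p′
extend-⊕ G p p′ = ListP.concatMap-++ _ p p′

extend-neg : ∀ G p → extend G (neg p) ≋ neg (extend G p)
extend-neg G p = mk≋ λ w → trans (coeff-extend G (neg p) w) (trans (eval-neg p _)
   (trans (cong -_ (sym (coeff-extend G p w))) (sym (coeff-neg (extend G p) w))))

extend-linear : ∀ G → IsLinear (extend G)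
extend-linear G = record
  { cong-≋ = extend-congʳ G ; ⊕-hom = λ p q → ≡⇒≋ (extend-⊕ G p q) ; neg-hom = extend-neg G }

extend-⊕ˡ : ∀ G G′ p → extend (λ u → G u ⊕ G′ u) p ≋ extend G p ⊕ extend G′ p
extend-⊕ˡ G G′ p = mk≋ λ w → begin
    coeff (extend (λ u → G u ⊕ G′ u) p) w                      ≡⟨ coeff-extend _ p w ⟩
    eval p (λ u → coeff (G u ⊕ G′ u) w)                        ≡⟨ eval-congʳ p (λ u → coeff-⊕ (G u) (G′ u) w) ⟩
    eval p (λ u → coeff (G u) w + coeff (G′ u) w)              ≡⟨ eval-+ʳ p _ _ ⟩
    eval p (λ u → coeff (G u) w) + eval p (λ u → coeff (G′ u) w)
      ≡⟨ cong₂ _+_ (sym (coeff-extend G p w)) (sym (coeff-extend G′ p w)) ⟩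
    coeff (extend G p) w + coeff (extend G′ p) w               ≡⟨ sym (coeff-⊕ (extend G p) _ w) ⟩
    coeff (extend G p ⊕ extend G′ p) w                         ∎
  where open ≡-Reasoning

extend-negˡ : ∀ G p → extend (λ u → neg (G u)) p ≋ neg (extend G p)
extend-negˡ G p = mk≋ λ w → begin
    coeff (extend (λ u → neg (G u)) p) w     ≡⟨ coeff-extend _ p w ⟩
    eval p (λ u → coeff (neg (G u)) w)       ≡⟨ eval-congʳ p (λ u → coeff-neg (G u) w) ⟩
    eval p (λ u → - coeff (G u) w)           ≡⟨ eval-negʳ p _ ⟩
    - eval p (λ u → coeff (G u) w)           ≡⟨ cong -_ (sym (coeff-extend G p w)) ⟩
    - coeff (extend G p) w                   ≡⟨ sym (coeff-neg (extend G p) w) ⟩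
    coeff (neg (extend G p)) w               ∎
  where open ≡-Reasoning

extend-prefixˡ : ∀ a G p → extend (λ u → prefix a (G u)) p ≡ prefix a (extend G p)
extend-prefixˡ a G [] = refl
extend-prefixˡ a G ((q , u) ∷ p) = begin
    scale q (prefix a (G u)) ++ extend (λ u → prefix a (G u)) p
      ≡⟨ cong₂ _++_ (sym (prefix-scale a q (G u))) (extend-prefixˡ a G p) ⟩
    prefix a (scale q (G u)) ++ prefix a (extend G p)  ≡⟨ sym (prefix-⊕ a (scale q (G u)) (extend G p)) ⟩
    prefix a (scale q (G u) ++ extend G p)             ∎
  where open ≡-Reasoning

extend-prefixʳ : ∀ a G p → extend G (prefix a p) ≡ extend (λ u → G (a ∷ u)) p
extend-prefixʳ a G [] = refl
extend-prefixʳ a G ((q , u) ∷ p) = cong (scale q (G (a ∷ u)) ++_) (extend-prefixʳ a G p)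

extend-word : ∀ p → extend word p ≋ p
extend-word [] = ≋-refl
extend-word ((q , u) ∷ p) rewrite ℚP.*-identityʳ q = ⊕-cong {p = [ (q , u) ]} ≋-refl (extend-word p)

·-as-extend : ∀ A B → A · B ≡ extend (λ u → prefixW u B) A
·-as-extend [] B = refl
·-as-extend ((q , u) ∷ A) B = cong₂ _++_ (row B) (·-as-extend A B)
  where
  row : ∀ r → map (λ { (q′ , v) → (q * q′ , u ++ v) }) r ≡ scale q (prefixW u r)
  row [] = refl
  row (_ ∷ r) = cong (_ ∷_) (row r)

ш-as-extend : ∀ A B → A ш B ≡ extend (λ u → extend (shW u) B) A
ш-as-extend [] B = refl
ш-as-extend ((q , u) ∷ A) B = cong₂ _++_ (row B) (ш-as-extend A B)
  where
  row : ∀ r → concatMap (λ { (q′ , v) → scale (q * q′) (shW u v) }) r ≡ scale q (extend (shW u) r)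
  row [] = refl
  row ((q′ , v) ∷ r) = trans (cong₂ _++_ (sym (scale-scale q q′ (shW u v))) (row r))
    (sym (scale-⊕ q (scale q′ (shW u v)) (extend (shW u) r)))

⋆-as-extend : ∀ A B → A ⋆ B ≡ extend (λ u → extend (hW u) B) A
⋆-as-extend [] B = refl
⋆-as-extend ((q , u) ∷ A) B = cong₂ _++_ (row B) (⋆-as-extend A B)
  where
  row : ∀ r → concatMap (λ { (q′ , v) → scale (q * q′) (hW u v) }) r ≡ scale q (extend (hW u) r)
  row [] = refl
  row ((q′ , v) ∷ r) = trans (cong₂ _++_ (sym (scale-scale q q′ (hW u v))) (row r))
    (sym (scale-⊕ q (scale q′ (hW u v)) (extend (hW u) r)))

X Y Z : Poly → Poly
X = prefix x
Y = prefix y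
Z p = X p ⊕ (Y p ⊕ 0P)

Z-cong : ∀ {p q} → p ≋ q → Z p ≋ Z q
Z-cong e = ⊕-cong (prefix-cong x e) (⊕-cong (prefix-cong y e) ≋-refl)

Z-⊕ : ∀ p q → Z (p ⊕ q) ≡ (X p ⊕ X q) ⊕ ((Y p ⊕ Y q) ⊕ 0P)
Z-⊕ p q = cong₂ (λ s t → s ⊕ (t ⊕ 0P)) (prefix-⊕ x p q) (prefix-⊕ y p q)

Z-linear : IsLinear Z
Z-linear = record
  { cong-≋ = Z-cong
  ; ⊕-hom = λ p q → ≋-trans (≡⇒≋ (Z-⊕ p q))
      (solve ((v₀ ⊞ v₁) ⊞ ((v₂ ⊞ v₃) ⊞ ∅)) ((v₀ ⊞ (v₂ ⊞ ∅)) ⊞ (v₁ ⊞ (v₃ ⊞ ∅)))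
             (X p ∷ X q ∷ Y p ∷ Y q ∷ []) refl)
  ; neg-hom = λ p → ≋-trans (≡⇒≋ (cong₂ (λ s t → s ⊕ (t ⊕ 0P)) (prefix-neg x p) (prefix-neg y p)))
      (solve (⊟ v₀ ⊞ (⊟ v₁ ⊞ ∅)) (⊟ (v₀ ⊞ (v₁ ⊞ ∅))) (X p ∷ Y p ∷ []) refl) }

·-congˡ : ∀ {A A′} B → A ≋ A′ → A · B ≋ A′ · B
·-congˡ {A} {A′} B e rewrite ·-as-extend A B | ·-as-extend A′ B = extend-congʳ _ e

·-linearˡ : ∀ B → IsLinear (_· B)
·-linearˡ B = record
  { cong-≋ = ·-congˡ B
  ; ⊕-hom = λ p q → ≡⇒≋ (ListP.concatMap-++ _ p q)
  ; neg-hom = λ p → ≋-trans (≡⇒≋ (·-as-extend (neg p) B))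
      (≋-trans (extend-neg _ p) (neg-cong (≡⇒≋ (sym (·-as-extend p B))))) }

·-prefixˡ : ∀ a P B → prefix a P · B ≋ prefix a (P · B)
·-prefixˡ a P B rewrite ·-as-extend (prefix a P) B | ·-as-extend P B =
  ≋-trans (≡⇒≋ (extend-prefixʳ a _ P))
    (≋-trans (extend-congˡ P (λ u → ≡⇒≋ (prefixW-∷ a u B))) (≡⇒≋ (extend-prefixˡ a _ P)))

Z-·ˡ : ∀ P B → Z P · B ≋ Z (P · B)
Z-·ˡ P B = ≋-trans (≡⇒≋ (trans (ListP.concatMap-++ _ (X P) _) (cong (X P · B ⊕_) (ListP.concatMap-++ _ (Y P) 0P))))
  (⊕-cong (·-prefixˡ x P B) (⊕-cong (·-prefixˡ y P B) ≋-refl))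

·-identityˡ : ∀ A → word [] · A ≋ A
·-identityˡ A rewrite ·-as-extend (word []) A =
  ≋-trans (⊕-identityʳ _) (≋-trans (scale-1ℚ _) (≡⇒≋ (prefixW-[] A)))

·-identityʳ : ∀ A → A · word [] ≋ A
·-identityʳ A rewrite ·-as-extend A (word []) =
  ≋-trans (extend-congˡ A (λ u → ≡⇒≋ (cong word (ListP.++-identityʳ u)))) (extend-word A)

z-· : ∀ A → zP · A ≋ Z A
z-· A rewrite ·-as-extend zP A =
  ⊕-cong (≋-trans (scale-1ℚ _) (≡⇒≋ (prefixW-[ x ] A))) (⊕-cong (≋-trans (scale-1ℚ _) (≡⇒≋ (prefixW-[ y ] A))) ≋-refl)

-y-· : ∀ A → myP · A ≋ neg (Y A)
-y-· A rewrite ·-as-extend myP A =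
  ≋-trans (⊕-identityʳ _) (≋-trans (scale-[-1ℚ] _) (≡⇒≋ (cong neg (prefixW-[ y ] A))))

·-[-y] : ∀ P → P · myP ≋ neg (P · yP)
·-[-y] P rewrite ·-as-extend P myP | ·-as-extend P yP = extend-negˡ (λ u → prefixW u yP) P

z·-· : ∀ P Q → (zP · P) · Q ≋ Z (P · Q)
z·-· P Q = ≋-trans (·-congˡ Q (z-· P)) (Z-·ˡ P Q)

-y·-· : ∀ P Q → (myP · P) · Q ≋ neg (Y (P · Q))
-y·-· P Q = begin
    (myP · P) · Q      ≈⟨ ·-congˡ Q (-y-· P) ⟩
    neg (Y P) · Q      ≈⟨ neg-hom (·-linearˡ Q) (Y P) ⟩
    neg (Y P · Q)      ≈⟨ neg-cong (·-prefixˡ y P Q) ⟩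
    neg (Y (P · Q))    ∎
  where open ≋-Reasoning

ш-congˡ : ∀ {A A′} B → A ≋ A′ → A ш B ≋ A′ ш B
ш-congˡ {A} {A′} B e rewrite ш-as-extend A B | ш-as-extend A′ B = extend-congʳ _ e

ш-congʳ : ∀ A {B B′} → B ≋ B′ → A ш B ≋ A ш B′
ш-congʳ A {B} {B′} e rewrite ш-as-extend A B | ш-as-extend A B′ =
  extend-congˡ A (λ u → extend-congʳ (shW u) e)

ш-negʳ : ∀ A B → A ш neg B ≋ neg (A ш B)
ш-negʳ A B rewrite ш-as-extend A (neg B) | ш-as-extend A B =
  ≋-trans (extend-congˡ A (λ u → extend-neg (shW u) B)) (extend-negˡ _ A)

ш-Zˡ : ∀ P B → Z P ш B ≡ X P ш B ⊕ (Y P ш B ⊕ 0P)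
ш-Zˡ P B = trans (ListP.concatMap-++ _ (X P) _) (cong (X P ш B ⊕_) (ListP.concatMap-++ _ (Y P) 0P))

ш-prefix-prefix : ∀ a b P Q → prefix a P ш prefix b Q ≋ prefix a (P ш prefix b Q) ⊕ prefix b (prefix a P ш Q)
ш-prefix-prefix a b P Q
  rewrite ш-as-extend (prefix a P) (prefix b Q) | ш-as-extend P (prefix b Q) | ш-as-extend (prefix a P) Q = begin
    extend (λ u → extend (shW u) (prefix b Q)) (prefix a P)  ≡⟨ extend-prefixʳ a _ P ⟩
    extend (λ u → extend (shW (a ∷ u)) (prefix b Q)) P       ≈⟨ extend-congˡ P word-level ⟩
    extend (λ u → prefix a (L u) ⊕ prefix b (R u)) P          ≈⟨ extend-⊕ˡ _ _ P ⟩
    extend (λ u → prefix a (L u)) P ⊕ extend (λ u → prefix b (R u)) P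
      ≡⟨ cong₂ _⊕_ (extend-prefixˡ a L P) (trans (extend-prefixˡ b R P) (cong (prefix b) (sym (extend-prefixʳ a _ P)))) ⟩
    prefix a (extend L P) ⊕ prefix b (extend (λ u → extend (shW u) Q) (prefix a P)) ∎
  where
  open ≋-Reasoning
  L R : Word → Poly
  L u = extend (shW u) (prefix b Q)
  R u = extend (shW (a ∷ u)) Q
  word-level : ∀ u → extend (shW (a ∷ u)) (prefix b Q) ≋ prefix a (L u) ⊕ prefix b (R u)
  word-level u = begin
    extend (shW (a ∷ u)) (prefix b Q)                                       ≡⟨ extend-prefixʳ b _ Q ⟩
    extend (λ v → prefix a (shW u (b ∷ v)) ⊕ prefix b (shW (a ∷ u) v)) Q   ≈⟨ extend-⊕ˡ _ _ Q ⟩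
    extend (λ v → prefix a (shW u (b ∷ v))) Q ⊕ extend (λ v → prefix b (shW (a ∷ u) v)) Q
      ≡⟨ cong₂ _⊕_ (trans (extend-prefixˡ a _ Q) (cong (prefix a) (sym (extend-prefixʳ b _ Q))))
                   (extend-prefixˡ b _ Q) ⟩
    prefix a (L u) ⊕ prefix b (R u)                                          ∎

ш-identityˡ : ∀ P → word [] ш P ≋ P
ш-identityˡ P rewrite ш-as-extend (word []) P =
  ≋-trans (⊕-identityʳ _) (≋-trans (scale-1ℚ _) (extend-word P))

shW-[]ʳ : ∀ u → shW u [] ≡ word u
shW-[]ʳ [] = refl
shW-[]ʳ (a ∷ u) = refl

ш-identityʳ : ∀ P → P ш word [] ≋ P
ш-identityʳ P rewrite ш-as-extend P (word []) =
  ≋-trans (extend-congˡ P (λ u → ≋-trans (⊕-identityʳ _) (≋-trans (scale-1ℚ _) (≡⇒≋ (shW-[]ʳ u)))))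
          (extend-word P)

z·-ш-[-y]· : ∀ P Q → (zP · P) ш (myP · Q) ≋ Z (P ш (myP · Q)) ⊕ neg (Y ((zP · P) ш Q))
z·-ш-[-y]· P Q = begin
    (zP · P) ш (myP · Q)     ≈⟨ ≋-trans (ш-congˡ (myP · Q) (z-· P)) (ш-congʳ (Z P) (-y-· Q)) ⟩
    Z P ш neg (Y Q)          ≈⟨ ш-negʳ (Z P) (Y Q) ⟩
    neg (Z P ш Y Q)          ≡⟨ cong neg (ш-Zˡ P (Y Q)) ⟩
    neg (X P ш Y Q ⊕ (Y P ш Y Q ⊕ 0P))
      ≈⟨ neg-cong (⊕-cong (ш-prefix-prefix x y P Q) (⊕-cong (ш-prefix-prefix y y P Q) ≋-refl)) ⟩
    neg ((X T ⊕ Y (X P ш Q)) ⊕ ((Y T ⊕ Y (Y P ш Q)) ⊕ 0P))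
      ≈⟨ solve (⊟ ((v₀ ⊞ v₁) ⊞ ((v₂ ⊞ v₃) ⊞ ∅))) (⊟ (v₀ ⊞ (v₂ ⊞ ∅)) ⊞ ⊟ (v₁ ⊞ (v₃ ⊞ ∅)))
               (X T ∷ Y (X P ш Q) ∷ Y T ∷ Y (Y P ш Q) ∷ []) refl ⟩
    neg (Z T) ⊕ neg (Y (X P ш Q) ⊕ (Y (Y P ш Q) ⊕ 0P))
      ≡⟨ cong (λ t → neg (Z T) ⊕ neg t)
              (sym (trans (cong Y (ш-Zˡ P Q)) (trans (prefix-⊕ y (X P ш Q) _) (cong (Y (X P ш Q) ⊕_) (prefix-⊕ y (Y P ш Q) 0P))))) ⟩
    neg (Z T) ⊕ neg (Y (Z P ш Q))
      ≈⟨ ⊕-cong (≋-trans (≋-sym (neg-hom Z-linear T)) (Z-cong (≋-trans (≋-sym (ш-negʳ P (Y Q))) (ш-congʳ P (≋-sym (-y-· Q))))))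
                (neg-cong (prefix-cong y (ш-congˡ Q (≋-sym (z-· P))))) ⟩
    Z (P ш (myP · Q)) ⊕ neg (Y ((zP · P) ш Q)) ∎
  where
  open ≋-Reasoning
  T = P ш Y Q

-- The harmonic product with yⁿ

-- u ∈ 𝔥¹ iff y u ∈ 𝔥y.
In𝔥¹ : Poly → Set
In𝔥¹ p = All (λ t → EndsInY (y ∷ proj₂ t)) p

In𝔥y⇒In𝔥¹ : ∀ {p} → In𝔥y p → In𝔥¹ p
In𝔥y⇒In𝔥¹ [] = []
In𝔥y⇒In𝔥¹ ((u , refl) ∷ es) = (y ∷ u , refl) ∷ In𝔥y⇒In𝔥¹ es

In𝔥¹⇒In𝔥y-Y : ∀ {p} → In𝔥¹ p → In𝔥y (Y p)
In𝔥¹⇒In𝔥y-Y {[]} [] = []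
In𝔥¹⇒In𝔥y-Y {_ ∷ _} (e ∷ es) = e ∷ In𝔥¹⇒In𝔥y-Y es

In𝔥y-prefix : ∀ a {p} → In𝔥y p → In𝔥y (prefix a p)
In𝔥y-prefix a {[]} [] = []
In𝔥y-prefix a {_ ∷ _} ((u , refl) ∷ es) = (a ∷ u , refl) ∷ In𝔥y-prefix a es

In𝔥y-⊕ : ∀ {p q} → In𝔥y p → In𝔥y q → In𝔥y (p ⊕ q)
In𝔥y-⊕ [] eq = eq
In𝔥y-⊕ (e ∷ ep) eq = e ∷ In𝔥y-⊕ ep eq

In𝔥y-neg : ∀ {p} → In𝔥y p → In𝔥y (neg p)
In𝔥y-neg {[]} [] = []
In𝔥y-neg {_ ∷ _} (e ∷ es) = e ∷ In𝔥y-neg es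

In𝔥y-Z : ∀ {p} → In𝔥y p → In𝔥y (Z p)
In𝔥y-Z e = In𝔥y-⊕ (In𝔥y-prefix x e) (In𝔥y-⊕ (In𝔥y-prefix y e) [])

In𝔥y-·y : ∀ P → In𝔥y (P · yP)
In𝔥y-·y [] = []
In𝔥y-·y ((q , u) ∷ P) = (u , refl) ∷ In𝔥y-·y P

replicate-x-∷ʳ : ∀ m (w : Word) → replicate (suc m) x ++ w ≡ replicate m x ++ (x ∷ w)
replicate-x-∷ʳ zero w = refl
replicate-x-∷ʳ (suc m) w = cong (x ∷_) (replicate-x-∷ʳ m w)

-- toComp' m reads a word with m pending letters x.
fromComp-toComp′ : ∀ m u → fromComp (toComp' m (u ++ [ y ])) ≡ replicate m x ++ (u ++ [ y ])
fromComp-toComp′ m [] = ListP.++-identityʳ _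
fromComp-toComp′ m (x ∷ u) = trans (fromComp-toComp′ (suc m) u) (replicate-x-∷ʳ m (u ++ [ y ]))
fromComp-toComp′ m (y ∷ u) = trans (cong ((replicate m x ++ [ y ]) ++_) (fromComp-toComp′ 0 u))
                                   (ListP.++-assoc (replicate m x) [ y ] (u ++ [ y ]))

fromComp-toComp-𝔥¹ : ∀ {v} → EndsInY (y ∷ v) → fromComp (toComp v) ≡ v
fromComp-toComp-𝔥¹ ([] , refl) = refl
fromComp-toComp-𝔥¹ (y ∷ u , refl) = fromComp-toComp′ 0 u

toComp′-step : ∀ m u → ∃ λ k → ∃ λ c →
  toComp' m (u ++ [ y ]) ≡ k ∷ c × toComp' (suc m) (u ++ [ y ]) ≡ suc k ∷ c
toComp′-step m [] = m , [] , refl , refl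
toComp′-step m (x ∷ u) = toComp′-step (suc m) u
toComp′-step m (y ∷ u) = m , _ , refl , refl

yⁿ⋆ : ℕ → Poly → Poly
yⁿ⋆ n = extend (λ v → hC (replicate n 0) (toComp v))

yⁿ⋆-linear : ∀ n → IsLinear (yⁿ⋆ n)
yⁿ⋆-linear n = extend-linear _

y^-≡ : ∀ n → yP ^ n ≡ word (replicate n y)
y^-≡ zero = refl
y^-≡ (suc n) rewrite y^-≡ n = refl

toComp-yⁿ : ∀ n → toComp (replicate n y) ≡ replicate n 0
toComp-yⁿ zero = refl
toComp-yⁿ (suc n) = cong (0 ∷_) (toComp-yⁿ n)

y^-⋆ : ∀ n p → (yP ^ n) ⋆ p ≋ yⁿ⋆ n p
y^-⋆ n p rewrite ⋆-as-extend (yP ^ n) p | y^-≡ n =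
  ≋-trans (⊕-identityʳ _) (≋-trans (scale-1ℚ _)
    (extend-congˡ p (λ v → ≡⇒≋ (cong (λ r → hC r (toComp v)) (toComp-yⁿ n)))))

yⁿ⋆-zero : ∀ {p} → In𝔥¹ p → yⁿ⋆ 0 p ≋ p
yⁿ⋆-zero {p} e = ≋-trans (extend-congᴾ p e (λ v ev → ≡⇒≋ (cong word (fromComp-toComp-𝔥¹ ev)))) (extend-word p)

fromComp-zeros : ∀ n → fromComp (replicate n 0) ≡ replicate n y
fromComp-zeros zero = refl
fromComp-zeros (suc n) = cong (y ∷_) (fromComp-zeros n)

hC-[]ʳ : ∀ r → hC r [] ≡ word (fromComp r)
hC-[]ʳ [] = refl
hC-[]ʳ (_ ∷ r) = refl

yⁿ⋆-1 : ∀ n → yⁿ⋆ n (word []) ≋ word (replicate n y)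
yⁿ⋆-1 n = ≋-trans (⊕-identityʳ _) (≋-trans (scale-1ℚ _)
  (≡⇒≋ (trans (hC-[]ʳ (replicate n 0)) (cong word (fromComp-zeros n)))))

extend-⊕ˡ³ : ∀ F G H p → extend (λ u → F u ⊕ G u ⊕ H u) p ≋ extend F p ⊕ extend G p ⊕ extend H p
extend-⊕ˡ³ F G H p = ≋-trans (extend-⊕ˡ (λ u → F u ⊕ G u) H p) (⊕-cong (extend-⊕ˡ F G p) ≋-refl)

yⁿ⋆-Y : ∀ n p → yⁿ⋆ (suc n) (Y p) ≋ Y (yⁿ⋆ n (Y p)) ⊕ Y (yⁿ⋆ (suc n) p) ⊕ X (Y (yⁿ⋆ n p))
yⁿ⋆-Y n p = begin
    yⁿ⋆ (suc n) (Y p) ≡⟨ extend-prefixʳ y _ p ⟩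
    extend (λ v → prefixW [ y ] (A v) ⊕ prefixW [ y ] (B v) ⊕ prefixW (x ∷ y ∷ []) (C v)) p
      ≈⟨ extend-congˡ p (λ v → ≡⇒≋ (cong₂ _⊕_ (cong₂ _⊕_ (prefixW-[ y ] (A v)) (prefixW-[ y ] (B v)))
                                   (trans (prefixW-∷ x [ y ] (C v)) (cong X (prefixW-[ y ] (C v)))))) ⟩
    extend (λ v → Y (A v) ⊕ Y (B v) ⊕ X (Y (C v))) p ≈⟨ extend-⊕ˡ³ _ _ _ p ⟩
    extend (λ v → Y (A v)) p ⊕ extend (λ v → Y (B v)) p ⊕ extend (λ v → X (Y (C v))) p
      ≡⟨ cong₂ _⊕_ (cong₂ _⊕_ (trans (extend-prefixˡ y A p) (cong Y (sym (extend-prefixʳ y _ p))))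
                              (extend-prefixˡ y B p))
                   (trans (extend-prefixˡ x (λ v → Y (C v)) p) (cong X (extend-prefixˡ y C p))) ⟩
    Y (yⁿ⋆ n (Y p)) ⊕ Y (yⁿ⋆ (suc n) p) ⊕ X (Y (yⁿ⋆ n p)) ∎
  where
  open ≋-Reasoning
  r = replicate n 0
  A B C : Word → Poly
  A v = hC r (0 ∷ toComp v)
  B v = hC (0 ∷ r) (toComp v)
  C v = hC r (toComp v)

X-hC-0∷ : ∀ r k c → X (hC (0 ∷ r) (k ∷ c)) ≡
  X (Y (hC r (k ∷ c))) ⊕ prefixW (zk (suc k)) (hC (0 ∷ r) c) ⊕ prefixW (zk (suc (suc k))) (hC r c)
X-hC-0∷ r k c = begin
    X (prefixW [ y ] A ⊕ prefixW (zk k) B ⊕ prefixW (zk (suc k)) C)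
      ≡⟨ prefix-⊕ x (prefixW [ y ] A ⊕ prefixW (zk k) B) _ ⟩
    X (prefixW [ y ] A ⊕ prefixW (zk k) B) ⊕ X (prefixW (zk (suc k)) C)
      ≡⟨ cong (_⊕ X (prefixW (zk (suc k)) C)) (prefix-⊕ x (prefixW [ y ] A) _) ⟩
    X (prefixW [ y ] A) ⊕ X (prefixW (zk k) B) ⊕ X (prefixW (zk (suc k)) C)
      ≡⟨ cong₂ _⊕_ (cong₂ _⊕_ (cong X (prefixW-[ y ] A)) (sym (prefixW-∷ x (zk k) B)))
                   (sym (prefixW-∷ x (zk (suc k)) C)) ⟩
    X (Y A) ⊕ prefixW (zk (suc k)) B ⊕ prefixW (zk (suc (suc k))) C ∎
  where
  open ≡-Reasoning
  A = hC r (k ∷ c)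
  B = hC (0 ∷ r) c
  C = hC r c

hC-x : ∀ r k c → hC (0 ∷ r) (suc k ∷ c) ≋
  Y (hC r (suc k ∷ c)) ⊕ X (hC (0 ∷ r) (k ∷ c)) ⊝ X (Y (hC r (k ∷ c)))
hC-x r k c = begin
    hC (0 ∷ r) (suc k ∷ c)
      ≡⟨ cong (λ t → t ⊕ prefixW (zk (suc k)) B ⊕ prefixW (zk (suc (suc k))) C) (prefixW-[ y ] A₁) ⟩
    Y A₁ ⊕ prefixW (zk (suc k)) B ⊕ prefixW (zk (suc (suc k))) C
      ≈⟨ solve (v₀ ⊞ v₁ ⊞ v₂) (v₀ ⊞ (v₃ ⊞ v₁ ⊞ v₂) ⊟ v₃)
               (Y A₁ ∷ prefixW (zk (suc k)) B ∷ prefixW (zk (suc (suc k))) C ∷ X (Y A₀) ∷ []) refl ⟩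
    Y A₁ ⊕ (X (Y A₀) ⊕ prefixW (zk (suc k)) B ⊕ prefixW (zk (suc (suc k))) C) ⊝ X (Y A₀)
      ≡⟨ cong (λ t → Y A₁ ⊕ t ⊝ X (Y A₀)) (sym (X-hC-0∷ r k c)) ⟩
    Y A₁ ⊕ X (hC (0 ∷ r) (k ∷ c)) ⊝ X (Y A₀) ∎
  where
  open ≋-Reasoning
  A₁ = hC r (suc k ∷ c)
  A₀ = hC r (k ∷ c)
  B = hC (0 ∷ r) c
  C = hC r c

hW-x : ∀ r u → hC (0 ∷ r) (toComp (x ∷ (u ++ [ y ]))) ≋
  Y (hC r (toComp (x ∷ (u ++ [ y ])))) ⊕ X (hC (0 ∷ r) (toComp (u ++ [ y ]))) ⊝ X (Y (hC r (toComp (u ++ [ y ]))))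
hW-x r u with toComp′-step 0 u
... | k , c , e₀ , e₁ rewrite e₀ | e₁ = hC-x r k c

yⁿ⋆-X : ∀ n p → In𝔥y p → yⁿ⋆ (suc n) (X p) ≋ Y (yⁿ⋆ n (X p)) ⊕ X (yⁿ⋆ (suc n) p) ⊝ X (Y (yⁿ⋆ n p))
yⁿ⋆-X n p p∈𝔥y = begin
    yⁿ⋆ (suc n) (X p) ≡⟨ extend-prefixʳ x _ p ⟩
    extend (λ v → hC (0 ∷ r) (toComp (x ∷ v))) p
      ≈⟨ extend-congᴾ p p∈𝔥y (λ { v (u , refl) → hW-x r u }) ⟩
    extend (λ v → Y (A v) ⊕ X (B v) ⊝ X (Y (C v))) p
      ≈⟨ extend-⊕ˡ (λ v → Y (A v) ⊕ X (B v)) (λ v → neg (X (Y (C v)))) p ⟩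
    extend (λ v → Y (A v) ⊕ X (B v)) p ⊕ extend (λ v → neg (X (Y (C v)))) p
      ≈⟨ ⊕-cong (extend-⊕ˡ (λ v → Y (A v)) (λ v → X (B v)) p) (extend-negˡ (λ v → X (Y (C v))) p) ⟩
    extend (λ v → Y (A v)) p ⊕ extend (λ v → X (B v)) p ⊝ extend (λ v → X (Y (C v))) p
      ≡⟨ cong₂ _⊝_ (cong₂ _⊕_ (trans (extend-prefixˡ y A p) (cong Y (sym (extend-prefixʳ x _ p))))
                              (extend-prefixˡ x B p))
                   (trans (extend-prefixˡ x (λ v → Y (C v)) p) (cong X (extend-prefixˡ y C p))) ⟩
    Y (yⁿ⋆ n (X p)) ⊕ X (yⁿ⋆ (suc n) p) ⊝ X (Y (yⁿ⋆ n p)) ∎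
  where
  open ≋-Reasoning
  r = replicate n 0
  A B C : Word → Poly
  A v = hC r (toComp (x ∷ v))
  B v = hC (0 ∷ r) (toComp v)
  C v = hC r (toComp v)

yⁿ⋆-Z : ∀ n p → In𝔥y p → yⁿ⋆ (suc n) (Z p) ≋ Y (yⁿ⋆ n (Z p)) ⊕ Z (yⁿ⋆ (suc n) p)
yⁿ⋆-Z n p p∈𝔥y = begin
    yⁿ⋆ (suc n) (Z p)      ≡⟨ extend-Z (suc n) ⟩
    yⁿ⋆ (suc n) (X p) ⊕ (yⁿ⋆ (suc n) (Y p) ⊕ 0P)  ≈⟨ ⊕-cong (yⁿ⋆-X n p p∈𝔥y) (⊕-cong (yⁿ⋆-Y n p) ≋-refl) ⟩
    (a ⊕ b ⊝ c) ⊕ ((d ⊕ e ⊕ c) ⊕ 0P)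
      ≈⟨ solve ((v₀ ⊞ v₁ ⊟ v₂) ⊞ ((v₃ ⊞ v₄ ⊞ v₂) ⊞ ∅)) ((v₀ ⊞ (v₃ ⊞ ∅)) ⊞ (v₁ ⊞ (v₄ ⊞ ∅)))
               (a ∷ b ∷ c ∷ d ∷ e ∷ []) refl ⟩
    (a ⊕ (d ⊕ 0P)) ⊕ Z (yⁿ⋆ (suc n) p)
      ≡⟨ cong (_⊕ Z (yⁿ⋆ (suc n) p)) (sym (trans (cong Y (extend-Z n))
            (trans (prefix-⊕ y (yⁿ⋆ n (X p)) _) (cong (a ⊕_) (prefix-⊕ y (yⁿ⋆ n (Y p)) 0P))))) ⟩
    Y (yⁿ⋆ n (Z p)) ⊕ Z (yⁿ⋆ (suc n) p) ∎
  where
  open ≋-Reasoning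
  extend-Z : ∀ m → yⁿ⋆ m (Z p) ≡ yⁿ⋆ m (X p) ⊕ (yⁿ⋆ m (Y p) ⊕ 0P)
  extend-Z m = trans (extend-⊕ _ (X p) _) (cong (yⁿ⋆ m (X p) ⊕_) (extend-⊕ _ (Y p) 0P))
  a = Y (yⁿ⋆ n (X p))
  b = X (yⁿ⋆ (suc n) p)
  c = X (Y (yⁿ⋆ n p))
  d = Y (yⁿ⋆ n (Y p))
  e = Y (yⁿ⋆ (suc n) p)

-- Alternating sums

-- altSum f b = Σ_{n + m = b} (-1)ⁿ f n m.
altSum : (ℕ → ℕ → Poly) → ℕ → Poly
altSum f zero = f 0 0
altSum f (suc b) = f 0 (suc b) ⊝ altSum (λ n m → f (suc n) m) b

negⁿ : ℕ → Poly → Poly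
negⁿ zero p = p
negⁿ (suc k) p = neg (negⁿ k p)

negⁿ-cong : ∀ k {p q} → p ≋ q → negⁿ k p ≋ negⁿ k q
negⁿ-cong zero e = e
negⁿ-cong (suc k) e = neg-cong (negⁿ-cong k e)

negⁿ-0P : ∀ k → negⁿ k 0P ≋ 0P
negⁿ-0P zero = ≋-refl
negⁿ-0P (suc k) = neg-cong (negⁿ-0P k)

negⁿ-+ : ∀ k l p → negⁿ k (negⁿ l p) ≡ negⁿ (k ℕ.+ l) p
negⁿ-+ zero l p = refl
negⁿ-+ (suc k) l p = cong neg (negⁿ-+ k l p)

altSum-cong : ∀ {f g} b → (∀ n m → f n m ≋ g n m) → altSum f b ≋ altSum g b
altSum-cong zero e = e 0 0
altSum-cong (suc b) e = ⊝-cong (e 0 (suc b)) (altSum-cong b (λ n m → e (suc n) m))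

altSum-linear : ∀ {L} → IsLinear L → ∀ f b → altSum (λ n m → L (f n m)) b ≋ L (altSum f b)
altSum-linear L-lin f zero = ≋-refl
altSum-linear {L} L-lin f (suc b) = begin
    L (f 0 (suc b)) ⊝ altSum (λ n m → L (f (suc n) m)) b ≈⟨ ⊝-cong ≋-refl (altSum-linear L-lin (λ n m → f (suc n) m) b) ⟩
    L (f 0 (suc b)) ⊝ L (altSum (λ n m → f (suc n) m) b) ≈⟨ ⊕-cong ≋-refl (≋-sym (neg-hom L-lin _)) ⟩
    L (f 0 (suc b)) ⊕ L (neg (altSum (λ n m → f (suc n) m) b)) ≈⟨ ≋-sym (⊕-hom L-lin _ _) ⟩
    L (f 0 (suc b) ⊝ altSum (λ n m → f (suc n) m) b) ∎
  where open ≋-Reasoning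

altSum-⊕ : ∀ f g b → altSum (λ n m → f n m ⊕ g n m) b ≋ altSum f b ⊕ altSum g b
altSum-⊕ f g zero = ≋-refl
altSum-⊕ f g (suc b) = begin
    (f 0 (suc b) ⊕ g 0 (suc b)) ⊝ altSum (λ n m → f (suc n) m ⊕ g (suc n) m) b
      ≈⟨ ⊝-cong ≋-refl (altSum-⊕ (λ n m → f (suc n) m) (λ n m → g (suc n) m) b) ⟩
    (f 0 (suc b) ⊕ g 0 (suc b)) ⊝ (altSum (λ n m → f (suc n) m) b ⊕ altSum (λ n m → g (suc n) m) b)
      ≈⟨ solve ((v₀ ⊞ v₁) ⊟ (v₂ ⊞ v₃)) ((v₀ ⊟ v₂) ⊞ (v₁ ⊟ v₃))
             (f 0 (suc b) ∷ g 0 (suc b) ∷ altSum (λ n m → f (suc n) m) b ∷ altSum (λ n m → g (suc n) m) b ∷ []) refl ⟩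
    altSum f (suc b) ⊕ altSum g (suc b) ∎
  where open ≋-Reasoning

altSum-last : ∀ f b → altSum f (suc b) ≋ altSum (λ n m → f n (suc m)) b ⊕ negⁿ (suc b) (f (suc b) 0)
altSum-last f zero = ≋-refl
altSum-last f (suc b) = begin
    f 0 (suc (suc b)) ⊝ altSum f′ (suc b) ≈⟨ ⊝-cong ≋-refl (altSum-last f′ b) ⟩
    f 0 (suc (suc b)) ⊝ (altSum (λ n m → f′ n (suc m)) b ⊕ negⁿ (suc b) (f′ (suc b) 0))
      ≈⟨ solve (v₀ ⊟ (v₁ ⊞ v₂)) ((v₀ ⊟ v₁) ⊞ ⊟ v₂)
               (f 0 (suc (suc b)) ∷ altSum (λ n m → f′ n (suc m)) b ∷ negⁿ (suc b) (f′ (suc b) 0) ∷ []) refl ⟩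
    altSum (λ n m → f n (suc m)) (suc b) ⊕ negⁿ (suc (suc b)) (f (suc (suc b)) 0) ∎
  where
  open ≋-Reasoning
  f′ = λ n m → f (suc n) m

altSum-only-last : ∀ f b → (∀ n m → f n (suc m) ≋ 0P) → altSum f b ≋ negⁿ b (f b 0)
altSum-only-last f zero f≋0 = ≋-refl
altSum-only-last f (suc b) f≋0 = begin
    f 0 (suc b) ⊝ altSum (λ n m → f (suc n) m) b
      ≈⟨ ⊝-cong (f≋0 0 b) (altSum-only-last (λ n m → f (suc n) m) b (λ n m → f≋0 (suc n) m)) ⟩
    0P ⊝ negⁿ b (f (suc b) 0) ∎
  where open ≋-Reasoning

yⁿ⋆-cong : ∀ n {p q} → p ≋ q → yⁿ⋆ n p ≋ yⁿ⋆ n q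
yⁿ⋆-cong n = cong-≋ (yⁿ⋆-linear n)

yⁿ⋆-zero-Z : ∀ {p} → In𝔥y p → yⁿ⋆ 0 (Z p) ≋ Z (yⁿ⋆ 0 p)
yⁿ⋆-zero-Z p∈𝔥y =
  ≋-trans (yⁿ⋆-zero (In𝔥y⇒In𝔥¹ (In𝔥y-Z p∈𝔥y))) (Z-cong (≋-sym (yⁿ⋆-zero (In𝔥y⇒In𝔥¹ p∈𝔥y))))

yⁿ⋆-zero-Y : ∀ {p} → In𝔥¹ p → yⁿ⋆ 0 (Y p) ≋ Y (yⁿ⋆ 0 p)
yⁿ⋆-zero-Y p∈𝔥¹ =
  ≋-trans (yⁿ⋆-zero (In𝔥y⇒In𝔥¹ (In𝔥¹⇒In𝔥y-Y p∈𝔥¹))) (prefix-cong y (≋-sym (yⁿ⋆-zero p∈𝔥¹)))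

altSum-yⁿ⋆-Z : ∀ (W : ℕ → Poly) → (∀ m → In𝔥y (W m)) → ∀ b →
  altSum (λ n m → yⁿ⋆ n (Z (W m))) (suc b)
    ≋ Z (altSum (λ n m → yⁿ⋆ n (W m)) (suc b)) ⊝ Y (altSum (λ n m → yⁿ⋆ n (Z (W m))) b)
altSum-yⁿ⋆-Z W W∈𝔥y b = begin
    yⁿ⋆ 0 (Z (W (suc b))) ⊝ altSum (λ n m → yⁿ⋆ (suc n) (Z (W m))) b
      ≈⟨ ⊝-cong (yⁿ⋆-zero-Z (W∈𝔥y (suc b))) (altSum-cong b (λ n m → yⁿ⋆-Z n (W m) (W∈𝔥y m))) ⟩
    P ⊝ altSum (λ n m → Y (yⁿ⋆ n (Z (W m))) ⊕ Z (yⁿ⋆ (suc n) (W m))) b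
      ≈⟨ ⊝-cong ≋-refl (≋-trans (altSum-⊕ _ _ b)
                       (⊕-cong (altSum-linear (prefix-linear y) _ b) (altSum-linear Z-linear _ b))) ⟩
    P ⊝ (Y A ⊕ Z B)
      ≈⟨ solve (v₀ ⊟ (v₁ ⊞ v₂)) ((v₀ ⊟ v₂) ⊟ v₁) (P ∷ Y A ∷ Z B ∷ []) refl ⟩
    (P ⊝ Z B) ⊝ Y A
      ≈⟨ ⊝-cong (≋-sym (≋-trans (⊕-hom Z-linear (yⁿ⋆ 0 (W (suc b))) (neg B)) (⊕-cong ≋-refl (neg-hom Z-linear B))))
                ≋-refl ⟩
    Z (yⁿ⋆ 0 (W (suc b)) ⊝ B) ⊝ Y A ∎
  where
  open ≋-Reasoning
  P = Z (yⁿ⋆ 0 (W (suc b)))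
  A = altSum (λ n m → yⁿ⋆ n (Z (W m))) b
  B = altSum (λ n m → yⁿ⋆ (suc n) (W m)) b

altSum-yⁿ⋆-Y : ∀ (V : ℕ → Poly) → (∀ m → In𝔥¹ (V m)) → ∀ b →
  altSum (λ n m → yⁿ⋆ n (Y (V m))) (suc b)
    ≋ Y (altSum (λ n m → yⁿ⋆ n (V m)) (suc b)) ⊝ Y (altSum (λ n m → yⁿ⋆ n (Y (V m))) b)
      ⊝ X (Y (altSum (λ n m → yⁿ⋆ n (V m)) b))
altSum-yⁿ⋆-Y V V∈𝔥¹ b = begin
    yⁿ⋆ 0 (Y (V (suc b))) ⊝ altSum (λ n m → yⁿ⋆ (suc n) (Y (V m))) b
      ≈⟨ ⊝-cong (yⁿ⋆-zero-Y (V∈𝔥¹ (suc b))) (altSum-cong b (λ n m → yⁿ⋆-Y n (V m))) ⟩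
    P ⊝ altSum (λ n m → Y (yⁿ⋆ n (Y (V m))) ⊕ Y (yⁿ⋆ (suc n) (V m)) ⊕ X (Y (yⁿ⋆ n (V m)))) b
      ≈⟨ ⊝-cong ≋-refl (≋-trans (altSum-⊕ _ _ b)
           (⊕-cong (≋-trans (altSum-⊕ _ _ b)
                      (⊕-cong (altSum-linear (prefix-linear y) _ b) (altSum-linear (prefix-linear y) _ b)))
                   (altSum-linear (∘-linear (prefix-linear x) (prefix-linear y)) _ b))) ⟩
    P ⊝ (Y A ⊕ Y B ⊕ X (Y C))
      ≈⟨ solve (v₀ ⊟ (v₁ ⊞ v₂ ⊞ v₃)) ((v₀ ⊟ v₂) ⊟ v₁ ⊟ v₃) (P ∷ Y A ∷ Y B ∷ X (Y C) ∷ []) refl ⟩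
    (P ⊝ Y B) ⊝ Y A ⊝ X (Y C)
      ≡⟨ cong (λ t → t ⊝ Y A ⊝ X (Y C))
              (trans (cong (P ⊕_) (sym (prefix-neg y B))) (sym (prefix-⊕ y (yⁿ⋆ 0 (V (suc b))) (neg B)))) ⟩
    Y (yⁿ⋆ 0 (V (suc b)) ⊝ B) ⊝ Y A ⊝ X (Y C) ∎
  where
  open ≋-Reasoning
  P = Y (yⁿ⋆ 0 (V (suc b)))
  A = altSum (λ n m → yⁿ⋆ n (Y (V m))) b
  B = altSum (λ n m → yⁿ⋆ (suc n) (V m)) b
  C = altSum (λ n m → yⁿ⋆ n (V m)) b

-- The hypotheses say U m = Σ_{j ≤ m} z^{m-j} y V j.
altSum-yⁿ⋆-zy : ∀ (V U : ℕ → Poly) → (∀ m → In𝔥¹ (V m)) → (∀ m → In𝔥y (U m)) →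
  U 0 ≋ Y (V 0) → (∀ m → U (suc m) ≋ Z (U m) ⊕ Y (V (suc m))) →
  ∀ b → altSum (λ n m → yⁿ⋆ n (U m)) b ≋ Y (altSum (λ n m → yⁿ⋆ n (V m)) b)
altSum-yⁿ⋆-zy V U V∈𝔥¹ U∈𝔥y U-zero U-suc = go
  where
  U₋ : ℕ → Poly
  U₋ zero = 0P
  U₋ (suc m) = U m

  U₋∈𝔥y : ∀ m → In𝔥y (U₋ m)
  U₋∈𝔥y zero = []
  U₋∈𝔥y (suc m) = U∈𝔥y m

  U-rec : ∀ m → U m ≋ Z (U₋ m) ⊕ Y (V m)
  U-rec zero = U-zero
  U-rec (suc m) = U-suc m

  ΣU ΣV ΣYV ΣZU₋ ΣU₋ : ℕ → Poly
  ΣU = altSum (λ n m → yⁿ⋆ n (U m))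
  ΣV = altSum (λ n m → yⁿ⋆ n (V m))
  ΣYV = altSum (λ n m → yⁿ⋆ n (Y (V m)))
  ΣZU₋ = altSum (λ n m → yⁿ⋆ n (Z (U₋ m)))
  ΣU₋ = altSum (λ n m → yⁿ⋆ n (U₋ m))

  split : ∀ b → ΣU b ≋ ΣZU₋ b ⊕ ΣYV b
  split b = ≋-trans (altSum-cong b (λ n m → ≋-trans (yⁿ⋆-cong n (U-rec m)) (⊕-hom (yⁿ⋆-linear n) (Z (U₋ m)) (Y (V m)))))
                    (altSum-⊕ (λ n m → yⁿ⋆ n (Z (U₋ m))) (λ n m → yⁿ⋆ n (Y (V m))) b)

  go : ∀ b → ΣU b ≋ Y (ΣV b)
  go zero = ≋-trans (split 0) (yⁿ⋆-zero-Y (V∈𝔥¹ 0))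
  go (suc b) = begin
      ΣU (suc b)                     ≈⟨ split (suc b) ⟩
      ΣZU₋ (suc b) ⊕ ΣYV (suc b)     ≈⟨ ⊕-cong (altSum-yⁿ⋆-Z U₋ U₋∈𝔥y b) (altSum-yⁿ⋆-Y V V∈𝔥¹ b) ⟩
      Z (ΣU₋ (suc b)) ⊝ Y (ΣZU₋ b) ⊕ (Y (ΣV (suc b)) ⊝ Y (ΣYV b) ⊝ X (Y (ΣV b)))
        ≈⟨ ⊕-cong (⊝-cong (Z-cong ΣU₋≋YΣV) (prefix-cong y ΣZU₋≋YΣV⊝ΣYV)) ≋-refl ⟩
      Z (Y (ΣV b)) ⊝ Y (Y (ΣV b) ⊝ ΣYV b) ⊕ (Y (ΣV (suc b)) ⊝ Y (ΣYV b) ⊝ X (Y (ΣV b)))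
        ≡⟨ cong (λ t → Z (Y (ΣV b)) ⊝ t ⊕ (Y (ΣV (suc b)) ⊝ Y (ΣYV b) ⊝ X (Y (ΣV b))))
               (trans (prefix-⊕ y (Y (ΣV b)) _) (cong (Y (Y (ΣV b)) ⊕_) (prefix-neg y (ΣYV b)))) ⟩
      (X (Y (ΣV b)) ⊕ (Y (Y (ΣV b)) ⊕ 0P)) ⊝ (Y (Y (ΣV b)) ⊝ Y (ΣYV b))
        ⊕ (Y (ΣV (suc b)) ⊝ Y (ΣYV b) ⊝ X (Y (ΣV b)))
        ≈⟨ solve ((v₀ ⊞ (v₁ ⊞ ∅)) ⊟ (v₁ ⊟ v₂) ⊞ (v₃ ⊟ v₂ ⊟ v₀)) v₃
                 (X (Y (ΣV b)) ∷ Y (Y (ΣV b)) ∷ Y (ΣYV b) ∷ Y (ΣV (suc b)) ∷ []) refl ⟩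
      Y (ΣV (suc b)) ∎
    where
    open ≋-Reasoning
    ΣU₋≋YΣV : ΣU₋ (suc b) ≋ Y (ΣV b)
    ΣU₋≋YΣV = ≋-trans (altSum-last (λ n m → yⁿ⋆ n (U₋ m)) b)
                (≋-trans (⊕-cong (go b) (negⁿ-0P (suc b))) (⊕-identityʳ _))
    ΣZU₋≋YΣV⊝ΣYV : ΣZU₋ b ≋ Y (ΣV b) ⊝ ΣYV b
    ΣZU₋≋YΣV⊝ΣYV = ≋-trans (solve v₀ ((v₀ ⊞ v₁) ⊟ v₁) (ΣZU₋ b ∷ ΣYV b ∷ []) refl)
                     (⊝-cong (≋-trans (≋-sym (split b)) (go b)) ≋-refl)

-- The key identity

Yⁿ : ℕ → Poly → Poly
Yⁿ zero p = p
Yⁿ (suc k) p = Y (Yⁿ k p)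

Yⁿ-cong : ∀ k {p q} → p ≋ q → Yⁿ k p ≋ Yⁿ k q
Yⁿ-cong zero e = e
Yⁿ-cong (suc k) e = prefix-cong y (Yⁿ-cong k e)

Y-negⁿ : ∀ k p → Y (negⁿ k p) ≡ negⁿ k (Y p)
Y-negⁿ zero p = refl
Y-negⁿ (suc k) p = trans (prefix-neg y (negⁿ k p)) (cong neg (Y-negⁿ k p))

Yⁿ-negⁿ : ∀ j k p → Yⁿ j (negⁿ k p) ≡ negⁿ k (Yⁿ j p)
Yⁿ-negⁿ zero k p = refl
Yⁿ-negⁿ (suc j) k p = trans (cong Y (Yⁿ-negⁿ j k p)) (Y-negⁿ k (Yⁿ j p))

Yⁿ-+ : ∀ k l p → Yⁿ k (Yⁿ l p) ≡ Yⁿ (k ℕ.+ l) p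
Yⁿ-+ zero l p = refl
Yⁿ-+ (suc k) l p = cong Y (Yⁿ-+ k l p)

Yⁿ-1 : ∀ n → Yⁿ n (word []) ≡ word (replicate n y)
Yⁿ-1 zero = refl
Yⁿ-1 (suc n) rewrite Yⁿ-1 n = refl

[-y]^-· : ∀ k P → (myP ^ k) · P ≋ negⁿ k (Yⁿ k P)
[-y]^-· zero P = ·-identityˡ P
[-y]^-· (suc k) P = ≋-trans (-y·-· (myP ^ k) P)
  (≋-trans (neg-cong (prefix-cong y ([-y]^-· k P))) (≡⇒≋ (cong neg (Y-negⁿ k (Yⁿ k P)))))

signedY : ℕ → Poly
signedY k = negⁿ k (Yⁿ (suc k) (word []))

shuffleZY : ℕ → ℕ → Poly
shuffleZY c b = (zP ^ c) ш (myP ^ b)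

Z⊕negY-·ˡ : ∀ P Q B → (Z P ⊕ neg (Y Q)) · B ≋ Z (P · B) ⊕ neg (Y (Q · B))
Z⊕negY-·ˡ P Q B = ≋-trans (⊕-hom (·-linearˡ B) (Z P) (neg (Y Q)))
  (⊕-cong (Z-·ˡ P B) (≋-trans (neg-hom (·-linearˡ B) (Y Q)) (neg-cong (·-prefixˡ y Q B))))

shuffleZY-0-· : ∀ b B → shuffleZY 0 b · B ≋ (myP ^ b) · B
shuffleZY-0-· b B = ·-congˡ B (ш-identityˡ (myP ^ b))

shuffleZY-suc-0-· : ∀ c B → shuffleZY (suc c) 0 · B ≋ Z (shuffleZY c 0 · B)
shuffleZY-suc-0-· c B = begin
    shuffleZY (suc c) 0 · B     ≈⟨ ·-congˡ B (ш-identityʳ (zP ^ suc c)) ⟩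
    (zP · (zP ^ c)) · B         ≈⟨ z·-· (zP ^ c) B ⟩
    Z ((zP ^ c) · B)            ≈⟨ Z-cong (·-congˡ B (≋-sym (ш-identityʳ (zP ^ c)))) ⟩
    Z (shuffleZY c 0 · B)       ∎
  where open ≋-Reasoning

shuffleZY-suc-suc-· : ∀ c b B →
  shuffleZY (suc c) (suc b) · B ≋ Z (shuffleZY c (suc b) · B) ⊕ neg (Y (shuffleZY (suc c) b · B))
shuffleZY-suc-suc-· c b B =
  ≋-trans (·-congˡ B (z·-ш-[-y]· (zP ^ c) (myP ^ b))) (Z⊕negY-·ˡ (shuffleZY c (suc b)) (shuffleZY (suc c) b) B)

neg-shuffleZY-0-·-[-y]^suc : ∀ a b → neg (shuffleZY 0 b · (myP ^ suc a)) ≋ signedY (a ℕ.+ b)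
neg-shuffleZY-0-·-[-y]^suc a b = begin
    neg (shuffleZY 0 b · (myP ^ suc a))        ≈⟨ neg-cong (shuffleZY-0-· b _) ⟩
    neg ((myP ^ b) · (myP ^ suc a))            ≈⟨ neg-cong ([-y]^-· b _) ⟩
    neg (negⁿ b (Yⁿ b (myP ^ suc a)))
      ≈⟨ neg-cong (negⁿ-cong b (Yⁿ-cong b (≋-trans (≋-sym (·-identityʳ (myP ^ suc a))) ([-y]^-· (suc a) (word []))))) ⟩
    neg (negⁿ b (Yⁿ b (negⁿ (suc a) (Yⁿ (suc a) (word [])))))
      ≡⟨ cong (λ t → neg (negⁿ b t)) (Yⁿ-negⁿ b (suc a) _) ⟩
    neg (negⁿ b (negⁿ (suc a) (Yⁿ b (Yⁿ (suc a) (word [])))))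
      ≡⟨ cong neg (trans (negⁿ-+ b (suc a) _) (cong (negⁿ (b ℕ.+ suc a)) (Yⁿ-+ b (suc a) (word [])))) ⟩
    negⁿ (suc (b ℕ.+ suc a)) (Yⁿ (b ℕ.+ suc a) (word []))
      ≡⟨ cong (λ k → negⁿ (suc k) (Yⁿ k (word []))) (trans (ℕP.+-suc b a) (cong suc (ℕP.+-comm b a))) ⟩
    neg (neg (signedY (a ℕ.+ b)))              ≈⟨ neg-involutive _ ⟩
    signedY (a ℕ.+ b)                          ∎
  where open ≋-Reasoning

altSum-yⁿ⋆-shuffleZY·y : ∀ a b → altSum (λ n m → yⁿ⋆ n (shuffleZY m a · yP)) b ≋ signedY (a ℕ.+ b)
altSum-yⁿ⋆-shuffleZY·y zero b = begin
    altSum (λ n m → yⁿ⋆ n (shuffleZY m 0 · yP)) b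
      ≈⟨ altSum-cong b (λ n m → yⁿ⋆-cong n (·-congˡ yP (ш-identityʳ (zP ^ m)))) ⟩
    altSum (λ n m → yⁿ⋆ n ((zP ^ m) · yP)) b
      ≈⟨ altSum-yⁿ⋆-zy V (λ m → (zP ^ m) · yP) V∈𝔥¹ (λ m → In𝔥y-·y (zP ^ m)) (·-identityˡ yP)
           (λ m → ≋-trans (z·-· (zP ^ m) yP) (≋-sym (⊕-identityʳ _))) b ⟩
    Y (altSum (λ n m → yⁿ⋆ n (V m)) b)         ≈⟨ prefix-cong y (altSum-only-last _ b (λ n m → ≋-refl)) ⟩
    Y (negⁿ b (yⁿ⋆ b (word [])))               ≈⟨ prefix-cong y (negⁿ-cong b (≋-trans (yⁿ⋆-1 b) (≡⇒≋ (sym (Yⁿ-1 b))))) ⟩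
    Y (negⁿ b (Yⁿ b (word [])))                ≡⟨ Y-negⁿ b _ ⟩
    signedY b                                  ∎
  where
  open ≋-Reasoning
  V : ℕ → Poly
  V zero = word []
  V (suc m) = 0P
  V∈𝔥¹ : ∀ m → In𝔥¹ (V m)
  V∈𝔥¹ zero = ([] , refl) ∷ []
  V∈𝔥¹ (suc m) = []
altSum-yⁿ⋆-shuffleZY·y (suc a) b = begin
    altSum (λ n m → yⁿ⋆ n (U m)) b
      ≈⟨ altSum-yⁿ⋆-zy V U V∈𝔥¹ (λ m → In𝔥y-·y (shuffleZY m (suc a))) U-zero U-suc b ⟩
    Y (altSum (λ n m → yⁿ⋆ n (neg (shuffleZY m a · yP))) b)
      ≈⟨ prefix-cong y (altSum-cong b (λ n m → neg-hom (yⁿ⋆-linear n) (shuffleZY m a · yP))) ⟩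
    Y (altSum (λ n m → neg (yⁿ⋆ n (shuffleZY m a · yP))) b)
      ≈⟨ prefix-cong y (altSum-linear neg-linear (λ n m → yⁿ⋆ n (shuffleZY m a · yP)) b) ⟩
    Y (neg (altSum (λ n m → yⁿ⋆ n (shuffleZY m a · yP)) b))
      ≈⟨ prefix-cong y (neg-cong (altSum-yⁿ⋆-shuffleZY·y a b)) ⟩
    Y (neg (signedY (a ℕ.+ b)))
      ≡⟨ trans (prefix-neg y _) (cong neg (Y-negⁿ (a ℕ.+ b) _)) ⟩
    signedY (suc a ℕ.+ b) ∎
  where
  open ≋-Reasoning
  U V : ℕ → Poly
  U m = shuffleZY m (suc a) · yP
  V m = neg (shuffleZY m a · yP)
  V∈𝔥¹ : ∀ m → In𝔥¹ (V m)
  V∈𝔥¹ m = In𝔥y⇒In𝔥¹ (In𝔥y-neg (In𝔥y-·y (shuffleZY m a)))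
  U-zero : U 0 ≋ Y (V 0)
  U-zero = ≋-trans (shuffleZY-0-· (suc a) yP) (≋-trans (-y·-· (myP ^ a) yP)
    (≋-trans (neg-cong (prefix-cong y (≋-sym (shuffleZY-0-· a yP)))) (≡⇒≋ (sym (prefix-neg y _)))))
  U-suc : ∀ m → U (suc m) ≋ Z (U m) ⊕ Y (V (suc m))
  U-suc m = ≋-trans (shuffleZY-suc-suc-· m a yP)
    (⊕-cong {p = Z (U m)} ≋-refl (≡⇒≋ (sym (prefix-neg y (shuffleZY (suc m) a · yP)))))

w : ℕ → ℕ → ℕ → Poly
w a c m = ((zP ^ c) · shuffleZY m a) · yP

w∈𝔥y : ∀ a c m → In𝔥y (w a c m)
w∈𝔥y a c m = In𝔥y-·y ((zP ^ c) · shuffleZY m a)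

w-suc : ∀ a c m → w a (suc c) m ≋ Z (w a c m)
w-suc a c m = ≋-trans (·-congˡ yP (z·-· (zP ^ c) (shuffleZY m a))) (Z-·ˡ ((zP ^ c) · shuffleZY m a) yP)

altSum-yⁿ⋆-w : ∀ a c b → altSum (λ n m → yⁿ⋆ n (w a c m)) b ≋ neg (shuffleZY c b · (myP ^ suc a))
altSum-yⁿ⋆-w a zero b = begin
    altSum (λ n m → yⁿ⋆ n (w a 0 m)) b
      ≈⟨ altSum-cong b (λ n m → yⁿ⋆-cong n (·-congˡ yP (·-identityˡ (shuffleZY m a)))) ⟩
    altSum (λ n m → yⁿ⋆ n (shuffleZY m a · yP)) b  ≈⟨ altSum-yⁿ⋆-shuffleZY·y a b ⟩
    signedY (a ℕ.+ b)                              ≈⟨ ≋-sym (neg-shuffleZY-0-·-[-y]^suc a b) ⟩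
    neg (shuffleZY 0 b · (myP ^ suc a))            ∎
  where open ≋-Reasoning
altSum-yⁿ⋆-w a (suc c) zero = begin
    yⁿ⋆ 0 (w a (suc c) 0)                ≈⟨ yⁿ⋆-cong 0 (w-suc a c 0) ⟩
    yⁿ⋆ 0 (Z (w a c 0))                  ≈⟨ yⁿ⋆-zero-Z (w∈𝔥y a c 0) ⟩
    Z (yⁿ⋆ 0 (w a c 0))                  ≈⟨ Z-cong (altSum-yⁿ⋆-w a c 0) ⟩
    Z (neg (shuffleZY c 0 · Q))          ≈⟨ neg-hom Z-linear (shuffleZY c 0 · Q) ⟩
    neg (Z (shuffleZY c 0 · Q))          ≈⟨ neg-cong (≋-sym (shuffleZY-suc-0-· c Q)) ⟩
    neg (shuffleZY (suc c) 0 · Q)        ∎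
  where
  open ≋-Reasoning
  Q = myP ^ suc a
altSum-yⁿ⋆-w a (suc c) (suc b) = begin
    altSum (λ n m → yⁿ⋆ n (w a (suc c) m)) (suc b)
      ≈⟨ altSum-cong (suc b) (λ n m → yⁿ⋆-cong n (w-suc a c m)) ⟩
    altSum (λ n m → yⁿ⋆ n (Z (w a c m))) (suc b)
      ≈⟨ altSum-yⁿ⋆-Z (w a c) (w∈𝔥y a c) b ⟩
    Z (altSum (λ n m → yⁿ⋆ n (w a c m)) (suc b)) ⊝ Y (altSum (λ n m → yⁿ⋆ n (Z (w a c m))) b)
      ≈⟨ ⊝-cong (Z-cong (altSum-yⁿ⋆-w a c (suc b)))
                (prefix-cong y (≋-trans (altSum-cong b (λ n m → yⁿ⋆-cong n (≋-sym (w-suc a c m))))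
                                        (altSum-yⁿ⋆-w a (suc c) b))) ⟩
    Z (neg A) ⊝ Y (neg B)
      ≈⟨ ⊝-cong (neg-hom Z-linear A) (≡⇒≋ (prefix-neg y B)) ⟩
    neg (Z A) ⊝ neg (Y B)
      ≈⟨ solve (⊟ v₀ ⊟ ⊟ v₁) (⊟ (v₀ ⊞ ⊟ v₁)) (Z A ∷ Y B ∷ []) refl ⟩
    neg (Z A ⊕ neg (Y B))
      ≈⟨ neg-cong (≋-sym (shuffleZY-suc-suc-· c b Q)) ⟩
    neg (shuffleZY (suc c) (suc b) · Q) ∎
  where
  open ≋-Reasoning
  Q = myP ^ suc a
  A = shuffleZY c (suc b) · Q
  B = shuffleZY (suc c) b · Q

ΣyⁿStar : List (ℕ × Poly) → Poly
ΣyⁿStar L = foldr (λ { (n , v) acc → ((yP ^ n) ⋆ v) ⊕ acc }) 0P L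

ΣyⁿStar-++ : ∀ L L′ → ΣyⁿStar (L ++ L′) ≋ ΣyⁿStar L ⊕ ΣyⁿStar L′
ΣyⁿStar-++ [] L′ = ≋-refl
ΣyⁿStar-++ ((n , v) ∷ L) L′ = ≋-trans (⊕-cong ≋-refl (ΣyⁿStar-++ L L′))
  (solve (v₀ ⊞ (v₁ ⊞ v₂)) ((v₀ ⊞ v₁) ⊞ v₂) ((yP ^ n) ⋆ v ∷ ΣyⁿStar L ∷ ΣyⁿStar L′ ∷ []) refl)

negTerms : List (ℕ × Poly) → List (ℕ × Poly)
negTerms [] = []
negTerms ((n , v) ∷ L) = (n , neg v) ∷ negTerms L

ΣyⁿStar-negTerms : ∀ L → ΣyⁿStar (negTerms L) ≋ neg (ΣyⁿStar L)
ΣyⁿStar-negTerms [] = ≋-refl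
ΣyⁿStar-negTerms ((n , v) ∷ L) = ≋-trans (⊕-cong y^-⋆-neg (ΣyⁿStar-negTerms L))
  (≋-sym (neg-⊕ ((yP ^ n) ⋆ v) (ΣyⁿStar L)))
  where
  y^-⋆-neg : (yP ^ n) ⋆ neg v ≋ neg ((yP ^ n) ⋆ v)
  y^-⋆-neg = ≋-trans (y^-⋆ n (neg v)) (≋-trans (neg-hom (yⁿ⋆-linear n) v) (neg-cong (≋-sym (y^-⋆ n v))))

InSumYnStar-resp-≋ : ∀ {p q} → p ≋ q → InSumYnStar p → InSumYnStar q
InSumYnStar-resp-≋ p≋q (L , L-valid , p≈ΣL) = L , L-valid , λ u → trans (sym (coeff-≡ p≋q u)) (p≈ΣL u)

InSumYnStar-0P : InSumYnStar 0P
InSumYnStar-0P = [] , [] , λ u → refl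

InSumYnStar-yⁿ⋆ : ∀ n {v} → n ℕ.≥ 1 → In𝔥y v → InSumYnStar (yⁿ⋆ n v)
InSumYnStar-yⁿ⋆ n {v} n≥1 v∈𝔥y =
  (n , v) ∷ [] , (n≥1 , v∈𝔥y) ∷ [] , coeff-≡ (≋-sym (≋-trans (⊕-identityʳ ((yP ^ n) ⋆ v)) (y^-⋆ n v)))

InSumYnStar-⊕ : ∀ {p q} → InSumYnStar p → InSumYnStar q → InSumYnStar (p ⊕ q)
InSumYnStar-⊕ {p} {q} (L , L-valid , p≈ΣL) (L′ , L′-valid , q≈ΣL′) =
  L ++ L′ , ++⁺ L-valid L′-valid ,
  coeff-≡ (≋-trans (⊕-cong (mk≋ {p} {ΣyⁿStar L} p≈ΣL) (mk≋ {q} {ΣyⁿStar L′} q≈ΣL′)) (≋-sym (ΣyⁿStar-++ L L′)))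

InSumYnStar-neg : ∀ {p} → InSumYnStar p → InSumYnStar (neg p)
InSumYnStar-neg {p} (L , L-valid , p≈ΣL) =
  negTerms L , negTerms-valid L-valid ,
  coeff-≡ (≋-trans (neg-cong (mk≋ {p} {ΣyⁿStar L} p≈ΣL)) (≋-sym (ΣyⁿStar-negTerms L)))
  where
  negTerms-valid : ∀ {L} → All (λ { (n , v) → (n ℕ.≥ 1) × In𝔥y v }) L →
                   All (λ { (n , v) → (n ℕ.≥ 1) × In𝔥y v }) (negTerms L)
  negTerms-valid [] = []
  negTerms-valid ((n≥1 , v∈𝔥y) ∷ valid) = (n≥1 , In𝔥y-neg v∈𝔥y) ∷ negTerms-valid valid

InSumYnStar-altSum : ∀ {f} → (∀ n m → InSumYnStar (f n m)) → ∀ b → InSumYnStar (altSum f b)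
InSumYnStar-altSum f∈ zero = f∈ 0 0
InSumYnStar-altSum {f} f∈ (suc b) =
  InSumYnStar-⊕ {f 0 (suc b)} (f∈ 0 (suc b))
    (InSumYnStar-neg {altSum f′ b} (InSumYnStar-altSum {f′} (λ n m → f∈ (suc n) m) b))
  where
  f′ = λ n m → f (suc n) m

-- The n = 0 summand of the alternating sum is w a c b itself.
w⊝altSum-yⁿ⋆-w : ∀ a c b → InSumYnStar (w a c b ⊝ altSum (λ n m → yⁿ⋆ n (w a c m)) b)
w⊝altSum-yⁿ⋆-w a c zero = InSumYnStar-resp-≋ (≋-sym cancel) InSumYnStar-0P
  where
  cancel : w a c 0 ⊝ yⁿ⋆ 0 (w a c 0) ≋ 0P
  cancel = ≋-trans (⊝-cong ≋-refl (yⁿ⋆-zero (In𝔥y⇒In𝔥¹ (w∈𝔥y a c 0))))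
                   (solve (v₀ ⊟ v₀) ∅ (w a c 0 ∷ []) refl)
w⊝altSum-yⁿ⋆-w a c (suc b) = InSumYnStar-resp-≋ (≋-sym cancel)
  (InSumYnStar-altSum (λ n m → InSumYnStar-yⁿ⋆ (suc n) (ℕ.s≤s ℕ.z≤n) (w∈𝔥y a c m)) b)
  where
  tail = altSum (λ n m → yⁿ⋆ (suc n) (w a c m)) b
  cancel : w a c (suc b) ⊝ (yⁿ⋆ 0 (w a c (suc b)) ⊝ tail) ≋ tail
  cancel = ≋-trans (⊝-cong ≋-refl (⊝-cong (yⁿ⋆-zero (In𝔥y⇒In𝔥¹ (w∈𝔥y a c (suc b)))) ≋-refl))
                   (solve (v₀ ⊟ (v₀ ⊟ v₁)) v₁ (w a c (suc b) ∷ tail ∷ []) refl)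

proposition1 : (a b c : ℕ) →
    InSumYnStar ((((zP ^ c) ш (myP ^ b)) · (myP ^ suc a)) ⊝ (((zP ^ c) · ((zP ^ b) ш (myP ^ a))) · myP))
proposition1 a b c = InSumYnStar-resp-≋ (≋-sym lhs≋w⊝altSum) (w⊝altSum-yⁿ⋆-w a c b)
  where
  open ≋-Reasoning
  S = shuffleZY c b · (myP ^ suc a)
  lhs≋w⊝altSum : S ⊝ ((zP ^ c) · shuffleZY b a) · myP ≋ w a c b ⊝ altSum (λ n m → yⁿ⋆ n (w a c m)) b
  lhs≋w⊝altSum = begin
    S ⊝ ((zP ^ c) · shuffleZY b a) · myP  ≈⟨ ⊝-cong ≋-refl (·-[-y] ((zP ^ c) · shuffleZY b a)) ⟩
    S ⊝ neg (w a c b)                     ≈⟨ solve (v₀ ⊟ ⊟ v₁) (v₁ ⊟ ⊟ v₀) (S ∷ w a c b ∷ []) refl ⟩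
    w a c b ⊝ neg S                       ≈⟨ ⊝-cong ≋-refl (≋-sym (altSum-yⁿ⋆-w a c b)) ⟩
    w a c b ⊝ altSum (λ n m → yⁿ⋆ n (w a c m)) b ∎
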